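{- Let $n\ge 2$ and let $T$ be a centrally symmetric pseudotriangulation of $\mathcal{D}_n$. Let $S^{L}$ (the left star) be the centrally symmetric pseudotriangulation consisting of all left central chords $p^{L}$, and $S^{R}$ (the right star) the one consisting of all right central chords $p^{R}$, $p \in \{0,\dots,n-1,\bar 0,\dots,\overline{n-1}\}$. (i) If $T$ contains $\ell \ge 1$ centrally symmetric pairs of left central chords $\{p^{L}, \bar p^{L}\}$, then the flip distance from $T$ to $S^{L}$ is exactly $n-\ell$ and the flip distance from $T$ to $S^{R}$ is exactly $n+\ell-2$. (ii) If $T$ contains $r \ge 1$ centrally symmetric pairs of right central chords $\{p^{R}, \bar p^{R}\}$, then the flip distance from $T$ to $S^{R}$ is exactly $n-r$ and the flip distance from $T$ to $S^{L}$ is exactly $n+r-2$.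
   Context: Let $\mathcal{D}_n$ be the configuration consisting of a regular convex $2n$-gon together with a closed disk $\mathbb{D}$ centered at the center of the polygon, with radius small enough that $\mathbb{D}$ meets only the long diagonals (those joining opposite vertices) of the $2n$-gon. Label the vertices counterclockwise $0,1,\dots,n-1,\bar 0,\bar 1,\dots,\overline{n-1}$, so that $p$ and $\bar p$ are symmetric with respect to the center. The chords of $\mathcal{D}_n$ are: all diagonals of the $2n$-gon except the long ones, together with the segments with one endpoint at a vertex of the $2n$-gon and tangent to $\mathbb{D}$. Each vertex $p$ is the endpoint of two such tangent chords: $p^{L}$, passing tangent to $\mathbb{D}$ on its left, and $p^{R}$, passing tangent on its right (central chords). Two chords cross if their relative interiors intersect. A centrally symmetric pseudotriangulation of $\mathcal{D}_n$ is an inclusion-maximal crossing-free set of chords invariant under the central symmetry; it contains exactly $2n$ chords. A flip replaces one centrally symmetric pair of chords of such a pseudotriangulation by the unique other centrally symmetric pair of chords yielding again a centrally symmetric pseudotriangulation. The flip distance between two such pseudotriangulations is their distance in the graph whose vertices are the centrally symmetric pseudotriangulations and whose edges are flips. -}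

module Defs where

open import Data.Nat using (ℕ; zero; suc; _+_; _∸_; _≤_; _<_; _<ᵇ_; _⊓_; _⊔_)
open import Data.Bool using (Bool; true; false; if_then_else_)
open import Data.Product using (_×_; ∃)
open import Data.Sum using (_⊎_)
open import Data.Empty using (⊥)
open import Relation.Nullary using (¬_)
open import Relation.Binary.PropositionalEquality using (_≡_; _≢_)

-- Combinatorial model of the configuration D_n.
-- Vertices of the regular 2n-gon are the naturals 0 .. 2n-1, counterclockwise;
-- vertex p < n is the paper's p, vertex p + n is the paper's p̄.

bar : ℕ → ℕ → ℕ
bar n p = if p <ᵇ n then p + n else p ∸ n

-- Chords.  'diag a b' is the diagonal {a,b} (represented with a < b);
-- 'left p' is p^L and 'right p' is p^R (central chords tangent to the disk).
data Chord : Set where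
  diag  : ℕ → ℕ → Chord
  left  : ℕ → Chord
  right : ℕ → Chord

-- Which elements of Chord are genuine chords of D_n:
-- diagonals {a,b}, a < b < 2n, that are neither polygon edges
-- (b - a = 1 or b - a = 2n - 1) nor long diagonals (b - a = n).
Valid : ℕ → Chord → Set
Valid n (diag a b) = a < b × b < n + n × 2 ≤ b ∸ a × b ∸ a ≢ n × b ∸ a + 2 ≤ n + n
Valid n (left p)   = p < n + n
Valid n (right p)  = p < n + n

csym : ℕ → Chord → Chord
csym n (diag a b) = diag (bar n a ⊓ bar n b) (bar n a ⊔ bar n b)
csym n (left p)   = left (bar n p)
csym n (right p)  = right (bar n p)

-- p lies strictly inside the short arc cut off by the (non-long) diagonal {a,b}, a < b
InShort : ℕ → ℕ → ℕ → ℕ → Set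
InShort n a b p = (b ∸ a < n × a < p × p < b) ⊎ (n < b ∸ a × (p < a ⊎ b < p))

-- q lies strictly in the open half circle counterclockwise from p,
-- i.e. q ∈ {p+1, …, p+n-1} modulo 2n
CCW : ℕ → ℕ → ℕ → Set
CCW n p q = (p < q × q < p + n) ⊎ (q + n < p)

-- Crossing of chords (relative interiors intersect), derived from the geometry:
-- * two diagonals cross iff their endpoints interleave;
-- * a diagonal crosses a central chord from p iff p is strictly inside its short arc;
-- * two left (resp. two right) central chords never cross;
-- * p^L and q^R cross iff q is strictly in the ccw open half circle from p.
Crosses : ℕ → Chord → Chord → Set
Crosses n (diag a b) (diag c d) = (a < c × c < b × b < d) ⊎ (c < a × a < d × d < b)
Crosses n (diag a b) (left p)   = InShort n a b p
Crosses n (diag a b) (right p)  = InShort n a b p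
Crosses n (left p)   (diag a b) = InShort n a b p
Crosses n (right p)  (diag a b) = InShort n a b p
Crosses n (left p)   (left q)   = ⊥
Crosses n (right p)  (right q)  = ⊥
Crosses n (left p)   (right q)  = CCW n p q
Crosses n (right q)  (left p)   = CCW n p q

ChordSet : Set
ChordSet = Chord → Bool

IsCSPT : ℕ → ChordSet → Set
IsCSPT n T =
  (∀ c → T c ≡ true → Valid n c) ×
  (∀ c c′ → T c ≡ true → T c′ ≡ true → ¬ Crosses n c c′) ×
  (∀ c → Valid n c → T c ≡ false → ∃ λ c′ → T c′ ≡ true × Crosses n c c′) ×
  (∀ c → T c ≡ true → T (csym n c) ≡ true)

Flip : ℕ → ChordSet → ChordSet → Set
Flip n T T′ =
  IsCSPT n T × IsCSPT n T′ ×
  ∃ λ c → ∃ λ d →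
    T c ≡ true × T′ c ≡ false × T d ≡ false × T′ d ≡ true ×
    (∀ e → e ≢ c → e ≢ csym n c → e ≢ d → e ≢ csym n d → T e ≡ T′ e)

data FlipPath (n : ℕ) : ChordSet → ChordSet → ℕ → Set where
  done : ∀ {T T′} → (∀ c → T c ≡ T′ c) → FlipPath n T T′ zero
  step : ∀ {T U T′ k} → Flip n T U → FlipPath n U T′ k → FlipPath n T T′ (suc k)

FlipDist : ℕ → ChordSet → ChordSet → ℕ → Set
FlipDist n T T′ k = FlipPath n T T′ k × (∀ m → FlipPath n T T′ m → k ≤ m)

leftStar : ℕ → ChordSet
leftStar n (left p) = p <ᵇ n + n
leftStar n _        = false

rightStar : ℕ → ChordSet
rightStar n (right p) = p <ᵇ n + n
rightStar n _         = false

countBelow : (ℕ → Bool) → ℕ → ℕ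
countBelow f zero    = zero
countBelow f (suc k) = if f k then suc (countBelow f k) else countBelow f k

-- number of centrally symmetric pairs {p^L, p̄^L} (resp. {p^R, p̄^R}) in T;
-- each pair is counted via its representative p ∈ {0, …, n-1}
leftPairs : ℕ → ChordSet → ℕ
leftPairs n T = countBelow (λ p → T (left p)) n

rightPairs : ℕ → ChordSet → ℕ
rightPairs n T = countBelow (λ p → T (right p)) n

-- Flips change the number l of left pairs by at most one. When 1 ≤ l, consecutive left chords a^L, b^L
-- bound a triangle a x b of T, and x^L can be flipped in (for the diagonal ab, or for b^R when b = ā),
-- so l can be raised one step at a time up to n, where T is the left star; a middle left chord b^L
-- between a^L and c^L can be flipped out (for ac, or for c^R), so l can be lowered to 1. A single left
-- pair forces a single right pair, and the reflection of the polygon, which exchanges left and right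
-- chords, turns the remaining n - 1 flips to S^R into the left-star case. For the lower bounds, n - l
-- and the potential "n + l - 2 if l ≥ 1, else n - r" drop by at most one per flip, since a left pair
-- leaves room for at most one right pair. Part (ii) is part (i) for the reflected pseudotriangulation.

module Submission where

open import Defs
open import Data.Nat
open import Data.Nat.Properties
open import Data.Bool using (Bool; true; false; if_then_else_)
open import Data.Bool.Properties using (not-¬)
open import Data.Product
open import Data.Sum using (_⊎_; inj₁; inj₂; [_,_]′)
open import Data.Empty
open import Relation.Nullary
open import Relation.Nullary.Decidable using (_×-dec_; ¬?; toSum)
open import Relation.Binary using (tri<; tri≈; tri>)
open import Relation.Binary.PropositionalEquality
open import Function using (_∘′_)
open import Algebra.Properties.CommutativeSemigroup +-commutativeSemigroup using (xy∙z≈xz∙y)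

-- Central symmetry

high≰low : ∀ {n m} k → m < n → k + n ≰ m
high≰low {n} k m<n k+n≤m = <⇒≱ m<n (≤-trans (m≤n+m n k) k+n≤m)

data BarView (n p : ℕ) : Set where
  low  : p < n → bar n p ≡ p + n → BarView n p
  high : ∀ k → p ≡ k + n → bar n p ≡ k → BarView n p

barView : ∀ n p → BarView n p
barView n p with p <ᵇ n in eq | <ᵇ-reflects-< p n
... | true  | ofʸ p<n = low p<n (cong (λ b → if b then p + n else p ∸ n) eq)
... | false | ofⁿ p≮n = high (p ∸ n) (sym (m∸n+n≡m (≮⇒≥ p≮n))) (cong (λ b → if b then p + n else p ∸ n) eq)

bar-low : ∀ {n p} → p < n → bar n p ≡ p + n
bar-low {n} {p} p<n with barView n p
... | low _ e = e
... | high k refl _ = ⊥-elim (high≰low k p<n ≤-refl)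

bar-high : ∀ {n} k → bar n (k + n) ≡ k
bar-high {n} k with barView n (k + n)
... | low k+n<n _ = ⊥-elim (high≰low k k+n<n ≤-refl)
... | high j e e′ = trans e′ (+-cancelʳ-≡ n j k (sym e))

bar-< : ∀ {n p} → p < n + n → bar n p < n + n
bar-< {n} {p} p<2n with barView n p
... | low p<n e = subst (_< n + n) (sym e) (+-monoˡ-< n p<n)
... | high k refl e = subst (_< n + n) (sym e) (<-≤-trans (+-cancelʳ-< n k n p<2n) (m≤m+n n n))

bar-involutive : ∀ {n p} → p < n + n → bar n (bar n p) ≡ p
bar-involutive {n} {p} p<2n with barView n p
... | low _ e = trans (cong (bar n) e) (bar-high {n} p)
... | high k refl e = trans (cong (bar n) e) (bar-low {n} (+-cancelʳ-< n k n p<2n))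

bar-≢ : ∀ {n p} → 0 < n → bar n p ≢ p
bar-≢ {n} {p} 0<n e with barView n p
... | low _ e′ = <-irrefl (trans (sym e) e′) (m<m+n p 0<n)
... | high k refl e′ = <-irrefl (trans (sym e′) e) (m<m+n k 0<n)

diag-injective : ∀ {a b c d} → diag a b ≡ diag c d → a ≡ c × b ≡ d
diag-injective refl = refl , refl

left-injective : ∀ {p q} → left p ≡ left q → p ≡ q
left-injective refl = refl

right-injective : ∀ {p q} → right p ≡ right q → p ≡ q
right-injective refl = refl

_≟ᶜ_ : (c d : Chord) → Dec (c ≡ d)
diag a b ≟ᶜ diag c d with a ≟ c | b ≟ d
... | yes refl | yes refl = yes refl
... | no a≢c   | _        = no (a≢c ∘′ proj₁ ∘′ diag-injective)
... | yes _    | no b≢d   = no (b≢d ∘′ proj₂ ∘′ diag-injective)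
left p ≟ᶜ left q = map′ (cong left) left-injective (p ≟ q)
right p ≟ᶜ right q = map′ (cong right) right-injective (p ≟ q)
diag _ _ ≟ᶜ left _ = no λ ()
diag _ _ ≟ᶜ right _ = no λ ()
left _ ≟ᶜ diag _ _ = no λ ()
left _ ≟ᶜ right _ = no λ ()
right _ ≟ᶜ diag _ _ = no λ ()
right _ ≟ᶜ left _ = no λ ()

Crosses-sym : ∀ n c d → Crosses n c d → Crosses n d c
Crosses-sym n (diag a b) (diag c d) (inj₁ x) = inj₂ x
Crosses-sym n (diag a b) (diag c d) (inj₂ x) = inj₁ x
Crosses-sym n (diag a b) (left p) x = x
Crosses-sym n (diag a b) (right p) x = x
Crosses-sym n (left p) (diag a b) x = x
Crosses-sym n (right p) (diag a b) x = x
Crosses-sym n (left p) (right q) x = x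
Crosses-sym n (right q) (left p) x = x

Crosses-irrefl : ∀ n c → ¬ Crosses n c c
Crosses-irrefl n (diag a b) (inj₁ (a<a , _)) = <-irrefl refl a<a
Crosses-irrefl n (diag a b) (inj₂ (a<a , _)) = <-irrefl refl a<a

module _ {a b : ℕ} (a≤b : a ≤ b) where

  private
    a+[b∸a]≡b : a + (b ∸ a) ≡ b
    a+[b∸a]≡b = m+[n∸m]≡n a≤b

  ∸<⇒<+ : ∀ {k} → b ∸ a < k → b < a + k
  ∸<⇒<+ {k} lt = subst (_< a + k) a+[b∸a]≡b (+-monoʳ-< a lt)

  <+⇒∸< : ∀ {k} → b < a + k → b ∸ a < k
  <+⇒∸< {k} lt = subst (b ∸ a <_) (m+n∸m≡n a k) (∸-monoˡ-< lt a≤b)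

  <∸⇒+< : ∀ {k} → k < b ∸ a → a + k < b
  <∸⇒+< {k} lt = subst (a + k <_) a+[b∸a]≡b (+-monoʳ-< a lt)

  +<⇒<∸ : ∀ {k} → a + k < b → k < b ∸ a
  +<⇒<∸ {k} lt = subst (_< b ∸ a) (m+n∸m≡n a k) (∸-monoˡ-< lt (m≤m+n a k))

  ≤∸⇒+≤ : ∀ {k} → k ≤ b ∸ a → a + k ≤ b
  ≤∸⇒+≤ {k} le = subst (a + k ≤_) a+[b∸a]≡b (+-monoʳ-≤ a le)

  +≤⇒≤∸ : ∀ {k} → a + k ≤ b → k ≤ b ∸ a
  +≤⇒≤∸ {k} le = subst (_≤ b ∸ a) (m+n∸m≡n a k) (∸-monoˡ-≤ a le)

  ∸+≤⇒+≤+ : ∀ {k m} → b ∸ a + k ≤ m → b + k ≤ a + m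
  ∸+≤⇒+≤+ {k} {m} le =
    subst (_≤ a + m) (trans (sym (+-assoc a (b ∸ a) k)) (cong (_+ k) a+[b∸a]≡b)) (+-monoʳ-≤ a le)

  +≤+⇒∸+≤ : ∀ {k m} → b + k ≤ a + m → b ∸ a + k ≤ m
  +≤+⇒∸+≤ {k} {m} le =
    +-cancelˡ-≤ a _ _ (subst (_≤ a + m) (trans (cong (_+ k) (sym a+[b∸a]≡b)) (+-assoc a (b ∸ a) k)) le)

  ∸≢⇒≢+ : ∀ {k} → b ∸ a ≢ k → b ≢ a + k
  ∸≢⇒≢+ {k} ne e = ne (trans (cong (_∸ a) e) (m+n∸m≡n a k))

  ≢+⇒∸≢ : ∀ {k} → b ≢ a + k → b ∸ a ≢ k
  ≢+⇒∸≢ ne e = ne (trans (sym a+[b∸a]≡b) (cong (a +_) e))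

-- Truncation-free forms of Valid and InShort for a diagonal {a, b} with a < b.
record ValidDiag (n a b : ℕ) : Set where
  constructor mkValidDiag
  field
    a<b      : a < b
    b<2n     : b < n + n
    a+2≤b    : a + 2 ≤ b
    b≢a+n    : b ≢ a + n
    b+2≤a+2n : b + 2 ≤ a + (n + n)

Valid⇒ValidDiag : ∀ {n a b} → Valid n (diag a b) → ValidDiag n a b
Valid⇒ValidDiag (a<b , b<2n , g , nl , g′) =
  mkValidDiag a<b b<2n (≤∸⇒+≤ (<⇒≤ a<b) g) (∸≢⇒≢+ (<⇒≤ a<b) nl) (∸+≤⇒+≤+ (<⇒≤ a<b) g′)

ValidDiag⇒Valid : ∀ {n a b} → ValidDiag n a b → Valid n (diag a b)
ValidDiag⇒Valid (mkValidDiag a<b b<2n g nl g′) =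
  a<b , b<2n , +≤⇒≤∸ (<⇒≤ a<b) g , ≢+⇒∸≢ (<⇒≤ a<b) nl , +≤+⇒∸+≤ (<⇒≤ a<b) g′

InShortArc : ℕ → ℕ → ℕ → ℕ → Set
InShortArc n a b p = (b < a + n × a < p × p < b) ⊎ (a + n < b × (p < a ⊎ b < p))

InShort⇒InShortArc : ∀ {n a b p} → a ≤ b → InShort n a b p → InShortArc n a b p
InShort⇒InShortArc a≤b (inj₁ (short , x)) = inj₁ (∸<⇒<+ a≤b short , x)
InShort⇒InShortArc a≤b (inj₂ (long , x)) = inj₂ (<∸⇒+< a≤b long , x)

InShortArc⇒InShort : ∀ {n a b p} → a ≤ b → InShortArc n a b p → InShort n a b p
InShortArc⇒InShort a≤b (inj₁ (short , x)) = inj₁ (<+⇒∸< a≤b short , x)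
InShortArc⇒InShort a≤b (inj₂ (long , x)) = inj₂ (+<⇒<∸ a≤b long , x)

sortedDiag : ℕ → ℕ → Chord
sortedDiag x y = diag (x ⊓ y) (x ⊔ y)

sortedDiag-≤ : ∀ {a b} → a ≤ b → sortedDiag a b ≡ diag a b
sortedDiag-≤ a≤b = cong₂ diag (m≤n⇒m⊓n≡m a≤b) (m≤n⇒m⊔n≡n a≤b)

sortedDiag-comm : ∀ x y → sortedDiag x y ≡ sortedDiag y x
sortedDiag-comm x y = cong₂ diag (⊓-comm x y) (⊔-comm x y)

private
  sort : ∀ {x y x′ y′} → x ≡ x′ → y ≡ y′ → x′ ≤ y′ → sortedDiag x y ≡ diag x′ y′
  sort ex ey le = trans (cong₂ sortedDiag ex ey) (sortedDiag-≤ le)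

data DiagView (n a b : ℕ) : Set where
  low-low   : a < n → b < n → csym n (diag a b) ≡ diag (a + n) (b + n) → DiagView n a b
  high-high : ∀ a′ b′ → a ≡ a′ + n → b ≡ b′ + n → csym n (diag a b) ≡ diag a′ b′ → DiagView n a b
  low-high  : ∀ b′ → a < n → b ≡ b′ + n → csym n (diag a b) ≡ diag b′ (a + n) → DiagView n a b

diagView : ∀ n {a b} → a < b → b < n + n → DiagView n a b
diagView n {a} {b} a<b b<2n with barView n a | barView n b
... | low a<n ea | low b<n eb = low-low a<n b<n (sort ea eb (+-monoˡ-≤ n (<⇒≤ a<b)))
... | low a<n ea | high b′ refl eb =
  low-high b′ a<n refl (trans (sortedDiag-comm (bar n a) (bar n b))
                              (sort eb ea (<⇒≤ (<-≤-trans (+-cancelʳ-< n b′ n b<2n) (m≤n+m n a)))))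
... | high a′ refl _ | low b<n _ = ⊥-elim (high≰low a′ b<n (<⇒≤ a<b))
... | high a′ refl ea | high b′ refl eb = high-high a′ b′ refl refl (sort ea eb (<⇒≤ (+-cancelʳ-< n a′ b′ a<b)))

csym-valid : ∀ n c → Valid n c → Valid n (csym n c)
csym-valid n (left p) v = bar-< {n} v
csym-valid n (right p) v = bar-< {n} v
csym-valid n (diag a b) v with Valid⇒ValidDiag v
... | mkValidDiag a<b b<2n a+2≤b b≢a+n b+2≤a+2n with diagView n a<b b<2n
...   | low-low a<n b<n e = subst (Valid n) (sym e) (ValidDiag⇒Valid (mkValidDiag
          (+-monoˡ-< n a<b)
          (+-monoˡ-< n b<n)
          (subst (_≤ b + n) (xy∙z≈xz∙y a 2 n) (+-monoˡ-≤ n a+2≤b))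
          (λ e′ → high≰low a b<n (≤-reflexive (sym (+-cancelʳ-≡ n b (a + n) e′))))
          (subst₂ _≤_ (xy∙z≈xz∙y b 2 n) (xy∙z≈xz∙y a (n + n) n) (+-monoˡ-≤ n b+2≤a+2n))))
...   | high-high a′ b′ refl refl e = subst (Valid n) (sym e) (ValidDiag⇒Valid (mkValidDiag
          (+-cancelʳ-< n a′ b′ a<b)
          (<-≤-trans b′<n (m≤m+n n n))
          (+-cancelʳ-≤ n (a′ + 2) b′ (subst (_≤ b′ + n) (xy∙z≈xz∙y a′ n 2) a+2≤b))
          (λ e′ → high≰low a′ b′<n (≤-reflexive (sym e′)))
          (≤-trans (subst₂ _≤_ (+-comm 2 b′) (+-comm 1 n) (s≤s b′<n))
                   (≤-trans (+-monoʳ-≤ n (≤-<-trans z≤n b′<n)) (m≤n+m (n + n) a′)))))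
  where
  b′<n : b′ < n
  b′<n = +-cancelʳ-< n b′ n b<2n
...   | low-high b′ a<n refl e = subst (Valid n) (sym e) (ValidDiag⇒Valid (mkValidDiag
          (<-≤-trans (+-cancelʳ-< n b′ n b<2n) (m≤n+m n a))
          (+-monoˡ-< n a<n)
          (+-cancelʳ-≤ n (b′ + 2) (a + n) (subst₂ _≤_ (xy∙z≈xz∙y b′ n 2) (sym (+-assoc a n n)) b+2≤a+2n))
          (b≢a+n ∘′ sym)
          (subst₂ _≤_ (xy∙z≈xz∙y a 2 n) (+-assoc b′ n n) (+-monoˡ-≤ n a+2≤b))))

csym-involutive : ∀ n c → Valid n c → csym n (csym n c) ≡ c
csym-involutive n (left p) v = cong left (bar-involutive {n} v)
csym-involutive n (right p) v = cong right (bar-involutive {n} v)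
csym-involutive n (diag a b) (a<b , b<2n , _) with diagView n a<b b<2n
... | low-low a<n b<n e with diagView n (+-monoˡ-< n a<b) (+-monoˡ-< n b<n)
...   | low-low a+n<n _ _ = ⊥-elim (high≰low a a+n<n ≤-refl)
...   | low-high _ a+n<n _ _ = ⊥-elim (high≰low a a+n<n ≤-refl)
...   | high-high a₂ b₂ ea eb e′ =
        trans (cong (csym n) e) (trans e′ (cong₂ diag (sym (+-cancelʳ-≡ n a a₂ ea)) (sym (+-cancelʳ-≡ n b b₂ eb))))
csym-involutive n (diag a b) (a<b , b<2n , _) | high-high a′ b′ refl refl e
  with diagView n (+-cancelʳ-< n a′ b′ a<b) (<-≤-trans b′<n (m≤m+n n n))
  where
  b′<n : b′ < n
  b′<n = +-cancelʳ-< n b′ n b<2n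
...   | low-low _ _ e′ = trans (cong (csym n) e) e′
...   | low-high b₂ _ eb _ = ⊥-elim (high≰low b₂ (+-cancelʳ-< n b′ n b<2n) (≤-reflexive (sym eb)))
...   | high-high _ b₂ _ eb _ = ⊥-elim (high≰low b₂ (+-cancelʳ-< n b′ n b<2n) (≤-reflexive (sym eb)))
csym-involutive n (diag a b) (a<b , b<2n , _) | low-high b′ a<n refl e
  with diagView n (<-≤-trans (+-cancelʳ-< n b′ n b<2n) (m≤n+m n a)) (+-monoˡ-< n a<n)
...   | low-low _ a+n<n _ = ⊥-elim (high≰low a a+n<n ≤-refl)
...   | high-high _ _ eb′ _ _ = ⊥-elim (high≰low _ (+-cancelʳ-< n b′ n b<2n) (≤-reflexive (sym eb′)))
...   | low-high a₂ _ ea e′ =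
        trans (cong (csym n) e) (trans e′ (cong (λ z → diag z (b′ + n)) (sym (+-cancelʳ-≡ n a a₂ ea))))

Interleaved : ℕ → ℕ → ℕ → ℕ → Set
Interleaved a b c d = (a < c × c < b × b < d) ⊎ (c < a × a < d × d < b)

Interleaved-sym : ∀ {a b c d} → Interleaved a b c d → Interleaved c d a b
Interleaved-sym (inj₁ x) = inj₂ x
Interleaved-sym (inj₂ x) = inj₁ x

module _ {n : ℕ} where

  private
    +n : ∀ {x y} → x < y → x + n < y + n
    +n = +-monoˡ-< n

    ∸n : ∀ {x y} → x + n < y + n → x < y
    ∸n = +-cancelʳ-< n _ _

    <+n : ∀ {x} y → x < n → x < y + n
    <+n {x} y x<n = <-≤-trans x<n (m≤n+m n y)

    high≮low : ∀ {x y} → x + n < y → y < n → ⊥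
    high≮low {x} lt y<n = high≰low x y<n (<⇒≤ lt)

  Interleaved-low-low : ∀ {a b c d} → Interleaved a b c d → Interleaved (a + n) (b + n) (c + n) (d + n)
  Interleaved-low-low (inj₁ (p , q , r)) = inj₁ (+n p , +n q , +n r)
  Interleaved-low-low (inj₂ (p , q , r)) = inj₂ (+n p , +n q , +n r)

  Interleaved-high-high : ∀ {a b c d} → Interleaved (a + n) (b + n) (c + n) (d + n) → Interleaved a b c d
  Interleaved-high-high (inj₁ (p , q , r)) = inj₁ (∸n p , ∸n q , ∸n r)
  Interleaved-high-high (inj₂ (p , q , r)) = inj₂ (∸n p , ∸n q , ∸n r)

  ¬Interleaved-low-high : ∀ {a b c d} → b < n → ¬ Interleaved a b (c + n) (d + n)
  ¬Interleaved-low-high b<n (inj₁ (_ , q , _)) = high≮low q b<n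
  ¬Interleaved-low-high b<n (inj₂ (p , q , r)) = high≮low p (<-trans (<-trans q r) b<n)

  Interleaved-low-mixed : ∀ {a b c d} → b < n → d < n → Interleaved a b c (d + n) → Interleaved (a + n) (b + n) d (c + n)
  Interleaved-low-mixed {a} _ d<n (inj₁ (p , q , _)) = inj₂ (<+n a d<n , +n p , +n q)
  Interleaved-low-mixed b<n _ (inj₂ (_ , _ , r)) = ⊥-elim (high≮low r b<n)

  Interleaved-high-mixed : ∀ {a b c d} → c < n → b < n → Interleaved (a + n) (b + n) c (d + n) → Interleaved a b d (c + n)
  Interleaved-high-mixed c<n _ (inj₁ (p , _ , _)) = ⊥-elim (high≮low p c<n)
  Interleaved-high-mixed {c = c} _ b<n (inj₂ (_ , q , r)) = inj₁ (∸n q , ∸n r , <+n c b<n)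

  Interleaved-mixed-mixed : ∀ {a b c d} → b < n → d < n → Interleaved a (b + n) c (d + n) → Interleaved b (a + n) d (c + n)
  Interleaved-mixed-mixed {a} b<n d<n (inj₁ (p , _ , r)) = inj₁ (∸n r , <+n a d<n , +n p)
  Interleaved-mixed-mixed {c = c} b<n d<n (inj₂ (p , _ , r)) = inj₂ (∸n r , <+n c b<n , +n p)

  InShortArc-low-low : ∀ {a b p} → InShortArc n a b p → InShortArc n (a + n) (b + n) (p + n)
  InShortArc-low-low (inj₁ (x , y , z)) = inj₁ (+n x , +n y , +n z)
  InShortArc-low-low (inj₂ (x , inj₁ y)) = inj₂ (+n x , inj₁ (+n y))
  InShortArc-low-low (inj₂ (x , inj₂ y)) = inj₂ (+n x , inj₂ (+n y))

  ¬InShortArc-low-high : ∀ {a b k} → b < n → ¬ InShortArc n a b (k + n)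
  ¬InShortArc-low-high b<n (inj₁ (_ , _ , z)) = high≮low z b<n
  ¬InShortArc-low-high b<n (inj₂ (x , _)) = high≮low x b<n

  ¬InShortArc-high-low : ∀ {a b p} → p < n → b < n → ¬ InShortArc n (a + n) (b + n) p
  ¬InShortArc-high-low p<n _ (inj₁ (_ , y , _)) = high≮low y p<n
  ¬InShortArc-high-low _ b<n (inj₂ (x , _)) = high≮low (∸n x) b<n

  InShortArc-high-high : ∀ {a b k} → InShortArc n (a + n) (b + n) (k + n) → InShortArc n a b k
  InShortArc-high-high (inj₁ (x , y , z)) = inj₁ (∸n x , ∸n y , ∸n z)
  InShortArc-high-high (inj₂ (x , inj₁ y)) = inj₂ (∸n x , inj₁ (∸n y))
  InShortArc-high-high (inj₂ (x , inj₂ y)) = inj₂ (∸n x , inj₂ (∸n y))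

  InShortArc-mixed-low : ∀ {a b p} → p < n → b < n → InShortArc n a (b + n) p → InShortArc n b (a + n) (p + n)
  InShortArc-mixed-low _ _ (inj₁ (x , y , _)) = inj₂ (x , inj₂ (+n y))
  InShortArc-mixed-low {p = p} _ b<n (inj₂ (x , inj₁ y)) = inj₁ (x , <+n p b<n , +n y)
  InShortArc-mixed-low p<n _ (inj₂ (_ , inj₂ y)) = ⊥-elim (high≮low y p<n)

  InShortArc-mixed-high : ∀ {a b k} → a < n → k < n → InShortArc n a (b + n) (k + n) → InShortArc n b (a + n) k
  InShortArc-mixed-high _ _ (inj₁ (x , _ , z)) = inj₂ (x , inj₁ (∸n z))
  InShortArc-mixed-high a<n _ (inj₂ (_ , inj₁ y)) = ⊥-elim (high≮low y a<n)
  InShortArc-mixed-high {a} _ k<n (inj₂ (x , inj₂ y)) = inj₁ (x , ∸n y , <+n a k<n)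

csym-Interleaved : ∀ n {a b c d} → Valid n (diag a b) → Valid n (diag c d) → Interleaved a b c d →
                   Crosses n (csym n (diag a b)) (csym n (diag c d))
csym-Interleaved n (a<b , b<2n , _) (c<d , d<2n , _) x with diagView n a<b b<2n | diagView n c<d d<2n
... | low-low _ b<n e₁ | low-low _ _ e₂ =
  subst₂ (Crosses n) (sym e₁) (sym e₂) (Interleaved-low-low x)
... | low-low _ b<n _ | high-high _ _ refl refl _ = ⊥-elim (¬Interleaved-low-high b<n x)
... | low-low _ b<n e₁ | low-high _ _ refl e₂ =
  subst₂ (Crosses n) (sym e₁) (sym e₂) (Interleaved-low-mixed b<n (+-cancelʳ-< n _ n d<2n) x)
... | high-high _ _ refl refl _ | low-low _ d<n _ = ⊥-elim (¬Interleaved-low-high d<n (Interleaved-sym x))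
... | high-high _ _ refl refl e₁ | high-high _ _ refl refl e₂ =
  subst₂ (Crosses n) (sym e₁) (sym e₂) (Interleaved-high-high x)
... | high-high _ _ refl refl e₁ | low-high _ c<n refl e₂ =
  subst₂ (Crosses n) (sym e₁) (sym e₂) (Interleaved-high-mixed c<n (+-cancelʳ-< n _ n b<2n) x)
... | low-high _ _ refl e₁ | low-low _ d<n e₂ =
  subst₂ (Crosses n) (sym e₁) (sym e₂) (Interleaved-sym (Interleaved-low-mixed d<n (+-cancelʳ-< n _ n b<2n) (Interleaved-sym x)))
... | low-high _ a<n refl e₁ | high-high _ _ refl refl e₂ =
  subst₂ (Crosses n) (sym e₁) (sym e₂) (Interleaved-sym (Interleaved-high-mixed a<n (+-cancelʳ-< n _ n d<2n) (Interleaved-sym x)))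
... | low-high _ _ refl e₁ | low-high _ _ refl e₂ =
  subst₂ (Crosses n) (sym e₁) (sym e₂) (Interleaved-mixed-mixed (+-cancelʳ-< n _ n b<2n) (+-cancelʳ-< n _ n d<2n) x)

private
  csym-InShortArc : ∀ n {a b p a′ b′ p′} → csym n (diag a b) ≡ diag a′ b′ → bar n p ≡ p′ → a′ < b′ →
                    InShortArc n a′ b′ p′ → Crosses n (csym n (diag a b)) (left (bar n p))
  csym-InShortArc n e e′ a′<b′ arc =
    subst₂ (λ c q → Crosses n c (left q)) (sym e) (sym e′) (InShortArc⇒InShort (<⇒≤ a′<b′) arc)

-- Stated for left (bar n p); since Crosses n (diag _ _) (right q) is the same InShort, it covers right chords too.
csym-InShort : ∀ n {a b p} → Valid n (diag a b) → p < n + n → InShort n a b p →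
               Crosses n (csym n (diag a b)) (left (bar n p))
csym-InShort n {a} {b} {p} (a<b , b<2n , _) p<2n ins with diagView n a<b b<2n | barView n p | InShort⇒InShortArc (<⇒≤ a<b) ins
... | low-low _ b<n e | low _ e′ | arc =
  csym-InShortArc n e e′ (+-monoˡ-< n a<b) (InShortArc-low-low arc)
... | low-low _ b<n _ | high _ refl _ | arc = ⊥-elim (¬InShortArc-low-high b<n arc)
... | high-high _ _ refl refl _ | low p<n _ | arc = ⊥-elim (¬InShortArc-high-low p<n (+-cancelʳ-< n _ n b<2n) arc)
... | high-high a′ b′ refl refl e | high _ refl e′ | arc =
  csym-InShortArc n e e′ (+-cancelʳ-< n a′ b′ a<b) (InShortArc-high-high arc)
... | low-high _ _ refl e | low p<n e′ | arc =
  csym-InShortArc n e e′ (<-≤-trans (+-cancelʳ-< n _ n b<2n) (m≤n+m n a)) (InShortArc-mixed-low p<n (+-cancelʳ-< n _ n b<2n) arc)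
... | low-high _ a<n refl e | high _ refl e′ | arc =
  csym-InShortArc n e e′ (<-≤-trans (+-cancelʳ-< n _ n b<2n) (m≤n+m n a)) (InShortArc-mixed-high a<n (+-cancelʳ-< n _ n p<2n) arc)

csym-CCW : ∀ n {p q} → p < n + n → q < n + n → CCW n p q → CCW n (bar n p) (bar n q)
csym-CCW n {p} {q} p<2n q<2n ccw with barView n p | barView n q | ccw
... | low _ e₁ | low _ e₂ | inj₁ (x , y) = subst₂ (CCW n) (sym e₁) (sym e₂) (inj₁ (+-monoˡ-< n x , +-monoˡ-< n y))
... | low p<n _ | low _ _ | inj₂ x = ⊥-elim (high≰low q p<n (<⇒≤ x))
... | low _ e₁ | high _ refl e₂ | inj₁ (_ , y) = subst₂ (CCW n) (sym e₁) (sym e₂) (inj₂ (+-monoˡ-< n (+-cancelʳ-< n _ _ y)))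
... | low p<n _ | high q′ refl _ | inj₂ x = ⊥-elim (high≰low (q′ + n) p<n (<⇒≤ x))
... | high _ refl _ | low q<n _ | inj₁ (x , _) = ⊥-elim (high≰low _ q<n (<⇒≤ x))
... | high _ refl e₁ | low q<n e₂ | inj₂ x =
  subst₂ (CCW n) (sym e₁) (sym e₂) (inj₁ (<-≤-trans (+-cancelʳ-< n _ n p<2n) (m≤n+m n q) , x))
... | high _ refl e₁ | high _ refl e₂ | inj₁ (x , y) =
  subst₂ (CCW n) (sym e₁) (sym e₂) (inj₁ (+-cancelʳ-< n _ _ x , +-cancelʳ-< n _ _ y))
... | high _ refl _ | high _ refl _ | inj₂ x = ⊥-elim (high≰low _ (+-cancelʳ-< n _ n p<2n) (<⇒≤ (+-cancelʳ-< n _ _ x)))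

csym-Crosses : ∀ n c d → Valid n c → Valid n d → Crosses n c d → Crosses n (csym n c) (csym n d)
csym-Crosses n (diag a b) (diag c d) vc vd x = csym-Interleaved n vc vd x
csym-Crosses n (diag a b) (left p) vc vd x = csym-InShort n vc vd x
csym-Crosses n (diag a b) (right p) vc vd x = csym-InShort n vc vd x
csym-Crosses n (left p) (diag a b) vc vd x = csym-InShort n vd vc x
csym-Crosses n (right p) (diag a b) vc vd x = csym-InShort n vd vc x
csym-Crosses n (left p) (right q) vc vd x = csym-CCW n vc vd x
csym-Crosses n (right q) (left p) vc vd x = csym-CCW n vd vc x

¬Crosses-csym : ∀ n c → Valid n c → ¬ Crosses n c (csym n c)
¬Crosses-csym n (diag a b) (a<b , b<2n , _) x with diagView n a<b b<2n
... | low-low _ b<n e with subst (Crosses n (diag a b)) e x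
...   | inj₁ (_ , a+n<b , _) = high≰low a b<n (<⇒≤ a+n<b)
...   | inj₂ (a+n<a , _) = <⇒≱ a+n<a (m≤m+n a n)
¬Crosses-csym n (diag a b) (a<b , b<2n , _) x | high-high a′ _ refl refl e with subst (Crosses n (diag a b)) e x
...   | inj₁ (a′+n<a′ , _) = <⇒≱ a′+n<a′ (m≤m+n a′ n)
...   | inj₂ (_ , a′+n<b′ , _) = high≰low a′ (+-cancelʳ-< n _ n b<2n) (<⇒≤ a′+n<b′)
¬Crosses-csym n (diag a b) (a<b , b<2n , _) x | low-high _ _ refl e with subst (Crosses n (diag a b)) e x
...   | inj₁ (p , _ , r) = <-asym p (+-cancelʳ-< n _ _ r)
...   | inj₂ (p , _ , r) = <-asym p (+-cancelʳ-< n _ _ r)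

Crosses-csymˡ : ∀ n c d → Valid n c → Valid n d → Crosses n (csym n c) d → Crosses n c (csym n d)
Crosses-csymˡ n c d vc vd x =
  subst (λ z → Crosses n z (csym n d)) (csym-involutive n c vc) (csym-Crosses n (csym n c) d (csym-valid n c vc) vd x)

Crosses-csymʳ : ∀ n c d → Valid n c → Valid n d → Crosses n c (csym n d) → Crosses n (csym n c) d
Crosses-csymʳ n c d vc vd x = Crosses-sym n d (csym n c) (Crosses-csymˡ n d c vd vc (Crosses-sym n c (csym n d) x))

-- Counting and searching

private
  below : ∀ {p m} → p < suc m → p ≢ m → p < m
  below p<1+m p≢m = ≤∧≢⇒< (≤-pred p<1+m) p≢m

module _ (f : ℕ → Bool) where

  countBelow-true : ∀ {m} → f m ≡ true → countBelow f (suc m) ≡ suc (countBelow f m)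
  countBelow-true {m} fm with f m
  countBelow-true refl | true = refl

  countBelow-false : ∀ {m} → f m ≡ false → countBelow f (suc m) ≡ countBelow f m
  countBelow-false {m} fm with f m
  countBelow-false refl | false = refl

  countBelow-≤ : ∀ m → countBelow f m ≤ m
  countBelow-≤ zero = z≤n
  countBelow-≤ (suc m) with f m
  ... | true = s≤s (countBelow-≤ m)
  ... | false = m≤n⇒m≤1+n (countBelow-≤ m)

  countBelow-suc-≤ : ∀ m → countBelow f (suc m) ≤ suc (countBelow f m)
  countBelow-suc-≤ m with f m
  ... | true = ≤-refl
  ... | false = n≤1+n _

  countBelow-≤-suc : ∀ m → countBelow f m ≤ countBelow f (suc m)
  countBelow-≤-suc m with f m
  ... | true = n≤1+n _
  ... | false = ≤-refl

  countBelow-pos : ∀ {m p} → p < m → f p ≡ true → 1 ≤ countBelow f m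
  countBelow-pos {suc m} {p} p<1+m fp with f m in fm | m ≟ p
  ... | true | _ = s≤s z≤n
  ... | false | yes refl = ⊥-elim (not-¬ fp fm)
  ... | false | no m≢p = countBelow-pos (below p<1+m (m≢p ∘′ sym)) fp

  countBelow-two : ∀ {m p q} → p < m → q < m → p ≢ q → f p ≡ true → f q ≡ true → 2 ≤ countBelow f m
  countBelow-two {suc m} {p} {q} p<1+m q<1+m p≢q fp fq with m ≟ p | m ≟ q
  ... | yes refl | _ = subst (2 ≤_) (sym (countBelow-true fp)) (s≤s (countBelow-pos (below q<1+m (p≢q ∘′ sym)) fq))
  ... | no _ | yes refl = subst (2 ≤_) (sym (countBelow-true fq)) (s≤s (countBelow-pos (below p<1+m p≢q) fp))
  ... | no m≢p | no m≢q =
    ≤-trans (countBelow-two (below p<1+m (m≢p ∘′ sym)) (below q<1+m (m≢q ∘′ sym)) p≢q fp fq) (countBelow-≤-suc m)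

  countBelow-witness : ∀ m → 1 ≤ countBelow f m → ∃ λ p → p < m × f p ≡ true
  countBelow-witness (suc m) pos with f m in fm
  ... | true = m , ≤-refl , fm
  ... | false = map₂ (map₁ m<n⇒m<1+n) (countBelow-witness m pos)

  countBelow-witness-false : ∀ m → countBelow f m < m → ∃ λ p → p < m × f p ≡ false
  countBelow-witness-false (suc m) lt with f m in fm
  ... | false = m , ≤-refl , fm
  ... | true = map₂ (map₁ m<n⇒m<1+n) (countBelow-witness-false m (≤-pred lt))

  countBelow-two-witnesses : ∀ m → 2 ≤ countBelow f m →
    ∃ λ p → ∃ λ q → p < m × q < m × p ≢ q × f p ≡ true × f q ≡ true
  countBelow-two-witnesses (suc m) two with f m in fm
  ... | true with countBelow-witness m (≤-pred two)
  ...   | q , q<m , fq = m , q , ≤-refl , m<n⇒m<1+n q<m , (λ e → <-irrefl (sym e) q<m) , fm , fq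
  countBelow-two-witnesses (suc m) two | false with countBelow-two-witnesses m two
  ...   | p , q , p<m , q<m , rest = p , q , m<n⇒m<1+n p<m , m<n⇒m<1+n q<m , rest

  countBelow-full : ∀ {m} → countBelow f m ≡ m → ∀ p → p < m → f p ≡ true
  countBelow-full {suc m} full p p<1+m with f m in fm
  ... | false = ⊥-elim (<⇒≱ (n<1+n m) (subst (_≤ m) full (countBelow-≤ m)))
  ... | true with m ≟ p
  ...   | yes refl = fm
  ...   | no m≢p = countBelow-full (suc-injective full) p (below p<1+m (m≢p ∘′ sym))

  countBelow-all : ∀ m → (∀ p → p < m → f p ≡ true) → countBelow f m ≡ m
  countBelow-all zero _ = refl
  countBelow-all (suc m) all = trans (countBelow-true (all m ≤-refl)) (cong suc (countBelow-all m (λ p → all p ∘′ m<n⇒m<1+n)))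

  countBelow-none : ∀ m → (∀ p → p < m → f p ≡ false) → countBelow f m ≡ 0
  countBelow-none zero _ = refl
  countBelow-none (suc m) none = trans (countBelow-false (none m ≤-refl)) (countBelow-none m (λ p → none p ∘′ m<n⇒m<1+n))

  countBelow-suc : ∀ m → countBelow f (suc m) ≡ countBelow (λ _ → f 0) 1 + countBelow (f ∘′ suc) m
  countBelow-suc zero with f 0
  ... | true = refl
  ... | false = refl
  countBelow-suc (suc m) with f (suc m)
  ... | true = trans (cong suc (countBelow-suc m)) (sym (+-suc _ _))
  ... | false = countBelow-suc m

countBelow-cong : ∀ {f g} m → (∀ p → p < m → f p ≡ g p) → countBelow f m ≡ countBelow g m
countBelow-cong zero _ = refl
countBelow-cong {f} {g} (suc m) eq with f m | g m | eq m ≤-refl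
... | true | true | _ = cong suc (countBelow-cong m (λ p → eq p ∘′ m<n⇒m<1+n))
... | false | false | _ = countBelow-cong m (λ p → eq p ∘′ m<n⇒m<1+n)

countBelow-mono : ∀ {f g} m → (∀ p → p < m → f p ≡ true → g p ≡ true) → countBelow f m ≤ countBelow g m
countBelow-mono zero _ = z≤n
countBelow-mono {f} {g} (suc m) sub with f m in fm | g m in gm
... | true | true = s≤s (countBelow-mono m (λ p → sub p ∘′ m<n⇒m<1+n))
... | false | true = m≤n⇒m≤1+n (countBelow-mono m (λ p → sub p ∘′ m<n⇒m<1+n))
... | false | false = countBelow-mono m (λ p → sub p ∘′ m<n⇒m<1+n)
... | true | false = ⊥-elim (not-¬ (sub m ≤-refl fm) gm)

countBelow-≤-suc-except : ∀ {f g} m i → (∀ p → p < m → p ≢ i → f p ≡ true → g p ≡ true) →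
                          countBelow f m ≤ suc (countBelow g m)
countBelow-≤-suc-except zero _ _ = z≤n
countBelow-≤-suc-except {f} {g} (suc m) i sub with m ≟ i
... | yes refl = begin
  countBelow f (suc m)       ≤⟨ countBelow-suc-≤ f m ⟩
  suc (countBelow f m)       ≤⟨ s≤s (countBelow-mono m (λ p p<m → sub p (m<n⇒m<1+n p<m) (<⇒≢ p<m))) ⟩
  suc (countBelow g m)       ≤⟨ s≤s (countBelow-≤-suc g m) ⟩
  suc (countBelow g (suc m)) ∎
  where open ≤-Reasoning
... | no m≢i with f m in fm
...   | true = s≤s (≤-trans ih (≤-reflexive (sym (countBelow-true g (sub m ≤-refl m≢i fm)))))
  where ih = countBelow-≤-suc-except m i (λ p → sub p ∘′ m<n⇒m<1+n)
...   | false = ≤-trans ih (s≤s (countBelow-≤-suc g m))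
  where ih = countBelow-≤-suc-except m i (λ p → sub p ∘′ m<n⇒m<1+n)

countBelow-insert : ∀ {f g} m {i} → i < m → f i ≡ false → g i ≡ true → (∀ p → p < m → p ≢ i → f p ≡ g p) →
                    countBelow g m ≡ suc (countBelow f m)
countBelow-insert {f} {g} (suc m) {i} i<1+m fi gi eq with m ≟ i
... | yes refl = begin
  countBelow g (suc m)       ≡⟨ countBelow-true g gi ⟩
  suc (countBelow g m)       ≡⟨ cong suc (countBelow-cong m (λ p p<m → sym (eq p (m<n⇒m<1+n p<m) (<⇒≢ p<m)))) ⟩
  suc (countBelow f m)       ≡⟨ cong suc (sym (countBelow-false f fi)) ⟩
  suc (countBelow f (suc m)) ∎
  where open ≡-Reasoning
... | no m≢i with f m | g m | eq m ≤-refl m≢i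
...   | true | true | _ = cong suc (countBelow-insert m i<m fi gi (λ p → eq p ∘′ m<n⇒m<1+n))
  where i<m = below i<1+m (m≢i ∘′ sym)
...   | false | false | _ = countBelow-insert m i<m fi gi (λ p → eq p ∘′ m<n⇒m<1+n)
  where i<m = below i<1+m (m≢i ∘′ sym)

countBelow-reverse : ∀ (f : ℕ → Bool) m → countBelow (λ i → f (m ∸ i)) m ≡ countBelow (f ∘′ suc) m
countBelow-reverse f zero = refl
countBelow-reverse f (suc m) = begin
  countBelow (λ i → f (suc m ∸ i)) (suc m)
    ≡⟨ countBelow-suc (λ i → f (suc m ∸ i)) m ⟩
  countBelow (λ _ → f (suc m)) 1 + countBelow (λ i → f (m ∸ i)) m
    ≡⟨ cong (countBelow (λ _ → f (suc m)) 1 +_) (countBelow-reverse f m) ⟩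
  countBelow (λ _ → f (suc m)) 1 + countBelow (f ∘′ suc) m
    ≡⟨ [b]+ (f (suc m)) ⟩
  countBelow (f ∘′ suc) (suc m) ∎
  where
  open ≡-Reasoning
  [b]+ : ∀ b {x} → countBelow (λ _ → b) 1 + x ≡ (if b then suc x else x)
  [b]+ true = refl
  [b]+ false = refl

module _ (f : ℕ → Bool) where

  NextTrue : ℕ → ℕ → Set
  NextTrue z top = ∃ λ b → z < b × b ≤ top × f b ≡ true × (∀ w → z < w → w < b → f w ≡ false)

  PrevTrue : ℕ → ℕ → Set
  PrevTrue bot z = ∃ λ a → bot ≤ a × a < z × f a ≡ true × (∀ w → a < w → w < z → f w ≡ false)

  private
    nextTrue-fuel : ∀ {top} → f top ≡ true → ∀ k z → top ≤ z + k → z < top → NextTrue z top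
    nextTrue-fuel ftop zero z top≤z z<top = ⊥-elim (<⇒≱ z<top (subst (_ ≤_) (+-identityʳ z) top≤z))
    nextTrue-fuel {top} ftop (suc k) z top≤z+k z<top with f (suc z) in fz
    ... | true = suc z , ≤-refl , z<top , fz , λ w z<w w<1+z → ⊥-elim (<⇒≱ z<w (≤-pred w<1+z))
    ... | false with m≤n⇒m<n∨m≡n z<top
    ...   | inj₂ refl = ⊥-elim (not-¬ ftop fz)
    ...   | inj₁ 1+z<top with nextTrue-fuel ftop k (suc z) (subst (top ≤_) (+-suc z k) top≤z+k) 1+z<top
    ...     | b , 1+z<b , b≤top , fb , between =
              b , <-trans (n<1+n z) 1+z<b , b≤top , fb , between′
      where
      between′ : ∀ w → z < w → w < b → f w ≡ false
      between′ w z<w w<b with m≤n⇒m<n∨m≡n z<w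
      ... | inj₁ 1+z<w = between w 1+z<w w<b
      ... | inj₂ refl = fz

  nextTrue : ∀ z top → z < top → f top ≡ true → NextTrue z top
  nextTrue z top z<top ftop = nextTrue-fuel ftop top z (m≤n+m top z) z<top

  prevTrue : ∀ bot z → bot < z → f bot ≡ true → PrevTrue bot z
  prevTrue bot (suc z) bot<1+z fbot with f z in fz
  ... | true = z , ≤-pred bot<1+z , ≤-refl , fz , λ w z<w w<1+z → ⊥-elim (<⇒≱ z<w (≤-pred w<1+z))
  ... | false with m≤n⇒m<n∨m≡n (≤-pred bot<1+z)
  ...   | inj₂ refl = ⊥-elim (not-¬ fbot fz)
  ...   | inj₁ bot<z with prevTrue bot z bot<z fbot
  ...     | a , bot≤a , a<z , fa , between =
            a , bot≤a , m<n⇒m<1+n a<z , fa , between′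
    where
    between′ : ∀ w → a < w → w < suc z → f w ≡ false
    between′ w a<w w<1+z with m≤n⇒m<n∨m≡n (≤-pred w<1+z)
    ... | inj₁ w<z = between w a<w w<z
    ... | inj₂ refl = fz

-- Flips

CrossedIn : ℕ → ChordSet → Chord → Set
CrossedIn n T e = ∃ λ k → T k ≡ true × Crosses n e k

module _ {n : ℕ} {T : ChordSet} (isT : IsCSPT n T) where

  IsCSPT-valid : ∀ c → T c ≡ true → Valid n c
  IsCSPT-valid = proj₁ isT

  IsCSPT-noncrossing : ∀ c c′ → T c ≡ true → T c′ ≡ true → ¬ Crosses n c c′
  IsCSPT-noncrossing = proj₁ (proj₂ isT)

  IsCSPT-maximal : ∀ c → Valid n c → T c ≡ false → CrossedIn n T c
  IsCSPT-maximal = proj₁ (proj₂ (proj₂ isT))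

  IsCSPT-symmetric : ∀ c → T c ≡ true → T (csym n c) ≡ true
  IsCSPT-symmetric = proj₂ (proj₂ (proj₂ isT))

  IsCSPT-symmetric-false : ∀ c → Valid n c → T c ≡ false → T (csym n c) ≡ false
  IsCSPT-symmetric-false c vc Tc with T (csym n c) in eq
  ... | false = refl
  ... | true = ⊥-elim (not-¬ (subst (λ z → T z ≡ true) (csym-involutive n c vc) (IsCSPT-symmetric (csym n c) eq)) Tc)

  IsCSPT-csym : ∀ c → Valid n c → T (csym n c) ≡ T c
  IsCSPT-csym c vc with T c in eq
  ... | true = IsCSPT-symmetric c eq
  ... | false = IsCSPT-symmetric-false c vc eq

≢-by-membership : ∀ {T : ChordSet} {x y} → T x ≡ true → T y ≡ false → x ≢ y
≢-by-membership Tx Ty refl = not-¬ Tx Ty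

csym-swap : ∀ n {x y} → Valid n x → csym n x ≡ y → x ≡ csym n y
csym-swap n {x} vx e = trans (sym (csym-involutive n x vx)) (cong (csym n) e)

module Replace (n : ℕ) {T : ChordSet} (isT : IsCSPT n T) {g d : Chord}
               (Tg : T g ≡ true) (vd : Valid n d) (Td : T d ≡ false) where

  private
    vg : Valid n g
    vg = IsCSPT-valid isT g Tg

  ḡ d̄ : Chord
  ḡ = csym n g
  d̄ = csym n d

  Tḡ : T ḡ ≡ true
  Tḡ = IsCSPT-symmetric isT g Tg

  Td̄ : T d̄ ≡ false
  Td̄ = IsCSPT-symmetric-false isT d vd Td

  T′ : ChordSet
  T′ e with e ≟ᶜ d | e ≟ᶜ d̄ | e ≟ᶜ g | e ≟ᶜ ḡ
  ... | yes _ | _     | _     | _     = true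
  ... | no _  | yes _ | _     | _     = true
  ... | no _  | no _  | yes _ | _     = false
  ... | no _  | no _  | no _  | yes _ = false
  ... | no _  | no _  | no _  | no _  = T e

  T′-d : T′ d ≡ true
  T′-d with d ≟ᶜ d
  ... | yes _ = refl
  ... | no d≢d = ⊥-elim (d≢d refl)

  T′-d̄ : T′ d̄ ≡ true
  T′-d̄ with d̄ ≟ᶜ d | d̄ ≟ᶜ d̄
  ... | yes _ | _ = refl
  ... | no _ | yes _ = refl
  ... | no _ | no d̄≢d̄ = ⊥-elim (d̄≢d̄ refl)

  T′-g : T′ g ≡ false
  T′-g with g ≟ᶜ d | g ≟ᶜ d̄ | g ≟ᶜ g
  ... | yes e | _ | _ = ⊥-elim (≢-by-membership {T} Tg Td e)
  ... | no _ | yes e | _ = ⊥-elim (≢-by-membership {T} Tg Td̄ e)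
  ... | no _ | no _ | yes _ = refl
  ... | no _ | no _ | no g≢g = ⊥-elim (g≢g refl)

  T′-ḡ : T′ ḡ ≡ false
  T′-ḡ with ḡ ≟ᶜ d | ḡ ≟ᶜ d̄ | ḡ ≟ᶜ g | ḡ ≟ᶜ ḡ
  ... | yes e | _ | _ | _ = ⊥-elim (≢-by-membership {T} Tḡ Td e)
  ... | no _ | yes e | _ | _ = ⊥-elim (≢-by-membership {T} Tḡ Td̄ e)
  ... | no _ | no _ | yes _ | _ = refl
  ... | no _ | no _ | no _ | yes _ = refl
  ... | no _ | no _ | no _ | no ḡ≢ḡ = ⊥-elim (ḡ≢ḡ refl)

  T′-other : ∀ e → e ≢ g → e ≢ ḡ → e ≢ d → e ≢ d̄ → T e ≡ T′ e
  T′-other e e≢g e≢ḡ e≢d e≢d̄ with e ≟ᶜ d | e ≟ᶜ d̄ | e ≟ᶜ g | e ≟ᶜ ḡ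
  ... | yes e≡d | _ | _ | _ = ⊥-elim (e≢d e≡d)
  ... | no _ | yes e≡d̄ | _ | _ = ⊥-elim (e≢d̄ e≡d̄)
  ... | no _ | no _ | yes e≡g | _ = ⊥-elim (e≢g e≡g)
  ... | no _ | no _ | no _ | yes e≡ḡ = ⊥-elim (e≢ḡ e≡ḡ)
  ... | no _ | no _ | no _ | no _ = refl

  T′-kept : ∀ e → T e ≡ true → e ≢ g → e ≢ ḡ → T′ e ≡ true
  T′-kept e Te e≢g e≢ḡ = trans (sym (T′-other e e≢g e≢ḡ (≢-by-membership {T} Te Td) (≢-by-membership {T} Te Td̄))) Te

  csym-≢-pair : ∀ {e} → Valid n e → e ≢ g → e ≢ ḡ → csym n e ≢ g × csym n e ≢ ḡ
  csym-≢-pair ve e≢g e≢ḡ = (λ ē≡g → e≢ḡ (csym-swap n ve ē≡g))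
                          , (λ ē≡ḡ → e≢g (trans (csym-swap n ve ē≡ḡ) (csym-involutive n g vg)))

  data InT′ (e : Chord) : Set where
    is-d    : e ≡ d → InT′ e
    is-d̄    : e ≡ d̄ → InT′ e
    is-kept : T e ≡ true → e ≢ g → e ≢ ḡ → InT′ e

  T′-true : ∀ e → T′ e ≡ true → InT′ e
  T′-true e T′e with e ≟ᶜ d | e ≟ᶜ d̄ | e ≟ᶜ g | e ≟ᶜ ḡ
  ... | yes e≡d | _ | _ | _ = is-d e≡d
  ... | no _ | yes e≡d̄ | _ | _ = is-d̄ e≡d̄
  ... | no _ | no _ | no e≢g | no e≢ḡ = is-kept T′e e≢g e≢ḡ

  T′-valid : ∀ e → T′ e ≡ true → Valid n e
  T′-valid e T′e with T′-true e T′e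
  ... | is-d refl = vd
  ... | is-d̄ refl = csym-valid n d vd
  ... | is-kept Te _ _ = IsCSPT-valid isT e Te

  T′-symmetric : ∀ e → T′ e ≡ true → T′ (csym n e) ≡ true
  T′-symmetric e T′e with T′-true e T′e
  ... | is-d refl = T′-d̄
  ... | is-d̄ refl = subst (λ z → T′ z ≡ true) (sym (csym-involutive n d vd)) T′-d
  ... | is-kept Te e≢g e≢ḡ = T′-kept (csym n e) (IsCSPT-symmetric isT e Te) (proj₁ ē≢) (proj₂ ē≢)
    where ē≢ = csym-≢-pair (IsCSPT-valid isT e Te) e≢g e≢ḡ

  T′-csym : ∀ e → Valid n e → T′ (csym n e) ≡ T′ e
  T′-csym e ve with T′ e in eq
  ... | true = T′-symmetric e eq
  ... | false with T′ (csym n e) in eq′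
  ...   | false = refl
  ...   | true = ⊥-elim (not-¬ (subst (λ z → T′ z ≡ true) (csym-involutive n e ve) (T′-symmetric (csym n e) eq′)) eq)

  module Flip-of (only-g-crosses-d : ∀ h → T h ≡ true → Crosses n d h → h ≡ g ⊎ h ≡ ḡ)
                 (g-crosses-d : Crosses n g d ⊎ Crosses n g d̄)
                 (g-crossers-blocked : ∀ e → Valid n e → T′ e ≡ false → Crosses n e g → CrossedIn n T′ e) where

    private
      d-noncrossing : ∀ e → T′ e ≡ true → ¬ Crosses n d e
      d-noncrossing e T′e x with T′-true e T′e
      ... | is-d refl = Crosses-irrefl n d x
      ... | is-d̄ refl = ¬Crosses-csym n d vd x
      ... | is-kept Te e≢g e≢ḡ = [ e≢g , e≢ḡ ]′ (only-g-crosses-d e Te x)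

      d̄-noncrossing : ∀ e → T′ e ≡ true → ¬ Crosses n d̄ e
      d̄-noncrossing e T′e x with T′-true e T′e
      ... | is-d refl = ¬Crosses-csym n d vd (Crosses-sym n d̄ d x)
      ... | is-d̄ refl = Crosses-irrefl n d̄ x
      ... | is-kept Te e≢g e≢ḡ =
            [ proj₁ ē≢ , proj₂ ē≢ ]′ (only-g-crosses-d (csym n e) (IsCSPT-symmetric isT e Te) (Crosses-csymˡ n d e vd ve x))
        where
        ve = IsCSPT-valid isT e Te
        ē≢ = csym-≢-pair ve e≢g e≢ḡ

      T′-noncrossing : ∀ c c′ → T′ c ≡ true → T′ c′ ≡ true → ¬ Crosses n c c′
      T′-noncrossing c c′ T′c T′c′ x with T′-true c T′c | T′-true c′ T′c′
      ... | is-d refl | _ = d-noncrossing c′ T′c′ x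
      ... | is-d̄ refl | _ = d̄-noncrossing c′ T′c′ x
      ... | is-kept _ _ _ | is-d refl = d-noncrossing c T′c (Crosses-sym n c d x)
      ... | is-kept _ _ _ | is-d̄ refl = d̄-noncrossing c T′c (Crosses-sym n c d̄ x)
      ... | is-kept Tc _ _ | is-kept Tc′ _ _ = IsCSPT-noncrossing isT c c′ Tc Tc′ x

      g-blocked : CrossedIn n T′ g
      g-blocked = [ (λ x → d , T′-d , x) , (λ x → d̄ , T′-d̄ , x) ]′ g-crosses-d

      ḡ-blocked : CrossedIn n T′ ḡ
      ḡ-blocked = [ (λ x → d̄ , T′-d̄ , csym-Crosses n g d vg vd x) , (λ x → d , T′-d , Crosses-csymʳ n g d vg vd x) ]′
                  g-crosses-d

      ḡ-crossers-blocked : ∀ e → Valid n e → T′ e ≡ false → Crosses n e ḡ → CrossedIn n T′ e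
      ḡ-crossers-blocked e ve T′e x
        with g-crossers-blocked (csym n e) (csym-valid n e ve) (trans (T′-csym e ve) T′e) (Crosses-csymʳ n e g ve vg x)
      ... | k , T′k , y = csym n k , T′-symmetric k T′k , Crosses-csymˡ n e k ve (T′-valid k T′k) y

      T′-maximal : ∀ e → Valid n e → T′ e ≡ false → CrossedIn n T′ e
      T′-maximal e ve T′e with toSum (e ≟ᶜ g) | toSum (e ≟ᶜ ḡ) | toSum (e ≟ᶜ d) | toSum (e ≟ᶜ d̄)
      ... | inj₁ refl | _ | _ | _ = g-blocked
      ... | inj₂ _ | inj₁ refl | _ | _ = ḡ-blocked
      ... | inj₂ _ | inj₂ _ | inj₁ refl | _ = ⊥-elim (not-¬ T′-d T′e)
      ... | inj₂ _ | inj₂ _ | inj₂ _ | inj₁ refl = ⊥-elim (not-¬ T′-d̄ T′e)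
      ... | inj₂ e≢g | inj₂ e≢ḡ | inj₂ e≢d | inj₂ e≢d̄
        with IsCSPT-maximal isT e ve (trans (T′-other e e≢g e≢ḡ e≢d e≢d̄) T′e)
      ...   | h , Th , x with toSum (h ≟ᶜ g) | toSum (h ≟ᶜ ḡ)
      ...     | inj₁ refl | _ = g-crossers-blocked e ve T′e x
      ...     | inj₂ _ | inj₁ refl = ḡ-crossers-blocked e ve T′e x
      ...     | inj₂ h≢g | inj₂ h≢ḡ = h , T′-kept h Th h≢g h≢ḡ , x

    T′-isCSPT : IsCSPT n T′
    T′-isCSPT = T′-valid , T′-noncrossing , T′-maximal , T′-symmetric

    flip : Flip n T T′
    flip = isT , T′-isCSPT , g , d , Tg , T′-g , Td , T′-d , T′-other

Flip-sym : ∀ {n T U} → Flip n T U → Flip n U T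
Flip-sym (isT , isU , c , d , Tc , Uc , Td , Ud , same) =
  isU , isT , d , c , Ud , Td , Uc , Tc , (λ e e≢d e≢d̄ e≢c e≢c̄ → sym (same e e≢c e≢c̄ e≢d e≢d̄))

data Side : Set where
  L R : Side

central : Side → ℕ → Chord
central L = left
central R = right

opposite : Side → Side
opposite L = R
opposite R = L

central-valid : ∀ s {n p} → p < n + n → Valid n (central s p)
central-valid L p<2n = p<2n
central-valid R p<2n = p<2n

csym-central : ∀ s n p → csym n (central s p) ≡ central s (bar n p)
csym-central L n p = refl
csym-central R n p = refl

centralPairs : Side → ℕ → ChordSet → ℕ
centralPairs s n T = countBelow (λ p → T (central s p)) n

representative : ℕ → ℕ → ℕ
representative n x with barView n x
... | low _ _ = x
... | high k _ _ = k

representative-< : ∀ n {x} → x < n + n → representative n x < n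
representative-< n {x} x<2n with barView n x
... | low x<n _ = x<n
... | high k refl _ = +-cancelʳ-< n k n x<2n

representative-cases : ∀ n x → representative n x ≡ x ⊎ representative n x ≡ bar n x
representative-cases n x with barView n x
... | low _ _ = inj₁ refl
... | high k _ e = inj₂ (sym e)

representative-unique : ∀ n {x p} → x < n + n → p < n → p ≡ x ⊎ p ≡ bar n x → p ≡ representative n x
representative-unique n {x} x<2n p<n p∈ with barView n x | p∈
... | low _ _ | inj₁ refl = refl
... | low _ e | inj₂ refl = ⊥-elim (high≰low x p<n (≤-reflexive (sym e)))
... | high k refl _ | inj₁ refl = ⊥-elim (high≰low k p<n ≤-refl)
... | high k refl e | inj₂ refl = e

centralIndex : Side → ℕ → Chord → ℕ
centralIndex L n (left x) = representative n x
centralIndex R n (right x) = representative n x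
centralIndex _ n _ = n

centralIndex-central : ∀ s n x → centralIndex s n (central s x) ≡ representative n x
centralIndex-central L n x = refl
centralIndex-central R n x = refl

central-∈-pair⇒index : ∀ s n {c p} → Valid n c → p < n → central s p ≡ c ⊎ central s p ≡ csym n c →
                       p ≡ centralIndex s n c
central-∈-pair⇒index s n {c} {p} vc p<n (inj₁ refl) =
  trans (representative-unique n (<-≤-trans p<n (m≤m+n n n)) p<n (inj₁ refl)) (sym (centralIndex-central s n p))
central-∈-pair⇒index s n {c} {p} vc p<n (inj₂ e) =
  trans (representative-unique n (bar-< {n} p<2n) p<n (inj₂ (sym (bar-involutive {n} p<2n))))
        (trans (sym (centralIndex-central s n (bar n p)))
               (cong (centralIndex s n) (trans (sym (csym-central s n p)) (trans (cong (csym n) e) (csym-involutive n c vc)))))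
  where p<2n = <-≤-trans p<n (m≤m+n n n)

centralPairs-Flip : ∀ s {n T U} → Flip n T U → centralPairs s n T ≤ suc (centralPairs s n U)
centralPairs-Flip s {n} {T} {U} (isT , isU , c , d , Tc , Uc , Td , Ud , same) =
  countBelow-≤-suc-except n (centralIndex s n c) kept
  where
  vc = IsCSPT-valid isT c Tc
  kept : ∀ p → p < n → p ≢ centralIndex s n c → T (central s p) ≡ true → U (central s p) ≡ true
  kept p p<n p≢i Tp = trans (sym (same (central s p)
    (λ e → p≢i (central-∈-pair⇒index s n vc p<n (inj₁ e)))
    (λ e → p≢i (central-∈-pair⇒index s n vc p<n (inj₂ e)))
    (≢-by-membership {T} Tp Td)
    (≢-by-membership {T} Tp (IsCSPT-symmetric-false isT d (IsCSPT-valid isU d Ud) Td)))) Tp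

centralPairs-insert : ∀ s n (T U : ChordSet) {x} → x < n + n →
  T (central s x) ≡ false → T (central s (bar n x)) ≡ false →
  U (central s x) ≡ true → U (central s (bar n x)) ≡ true →
  (∀ y → y ≢ x → y ≢ bar n x → T (central s y) ≡ U (central s y)) →
  centralPairs s n U ≡ suc (centralPairs s n T)
centralPairs-insert s n T U {x} x<2n Tx Tx̄ Ux Ux̄ same =
  countBelow-insert n (representative-< n x<2n) (at-representative T Tx Tx̄) (at-representative U Ux Ux̄)
    (λ p p<n p≢r → same p (λ e → p≢r (representative-unique n x<2n p<n (inj₁ e)))
                          (λ e → p≢r (representative-unique n x<2n p<n (inj₂ e))))
  where
  at-representative : ∀ (V : ChordSet) {b} → V (central s x) ≡ b → V (central s (bar n x)) ≡ b →
                      V (central s (representative n x)) ≡ b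
  at-representative V Vx Vx̄ with representative-cases n x
  ... | inj₁ e = subst (λ z → V (central s z) ≡ _) (sym e) Vx
  ... | inj₂ e = subst (λ z → V (central s z) ≡ _) (sym e) Vx̄

-- Consecutive left chords

InShortArc-separating-above : ∀ {n a b s t} → t ≢ s + n → a < s → s < b → b < t →
                              InShortArc n s t a ⊎ InShortArc n s t b
InShortArc-separating-above {n} {s = s} {t} t≢s+n a<s s<b b<t with <-cmp t (s + n)
... | tri< short _ _ = inj₂ (inj₁ (short , s<b , b<t))
... | tri≈ _ long _ = ⊥-elim (t≢s+n long)
... | tri> _ _ wide = inj₁ (inj₂ (wide , inj₁ a<s))

InShortArc-separating-below : ∀ {n a b s t} → t ≢ s + n → s < a → a < t → t < b →
                              InShortArc n s t a ⊎ InShortArc n s t b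
InShortArc-separating-below {n} {s = s} {t} t≢s+n s<a a<t t<b with <-cmp t (s + n)
... | tri< short _ _ = inj₁ (inj₁ (short , s<a , a<t))
... | tri≈ _ long _ = ⊥-elim (t≢s+n long)
... | tri> _ _ wide = inj₂ (inj₂ (wide , inj₂ t<b))

Valid-short : ∀ {n a b} → a + 2 ≤ b → b < a + n → b < n + n → Valid n (diag a b)
Valid-short {n} {a} {b} a+2≤b b<a+n b<2n =
  ValidDiag⇒Valid (mkValidDiag (<-≤-trans (m<m+n a (s≤s z≤n)) a+2≤b) b<2n a+2≤b (<⇒≢ b<a+n) b+2≤a+2n)
  where
  open ≤-Reasoning
  b+2≤a+2n : b + 2 ≤ a + (n + n)
  b+2≤a+2n = begin
    b + 2       ≡⟨ +-comm b 2 ⟩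
    suc (suc b) ≤⟨ s≤s b<a+n ⟩
    suc (a + n) ≡⟨ +-comm 1 (a + n) ⟩
    a + n + 1   ≤⟨ +-monoʳ-≤ (a + n) (≤-trans (s≤s z≤n) (+-cancelˡ-< a 2 n (≤-<-trans a+2≤b b<a+n))) ⟩
    a + n + n   ≡⟨ +-assoc a n n ⟩
    a + (n + n) ∎

module Geometry (n : ℕ) {T : ChordSet} (isT : IsCSPT n T) where

  leftIn : ℕ → Bool
  leftIn y = T (left y)

  HasLeft : ℕ → Set
  HasLeft y = leftIn y ≡ true

  NoLeftBetween : ℕ → ℕ → Set
  NoLeftBetween a b = ∀ z → a < z → z < b → T (left z) ≡ false

  -- a and x are joined by a polygon edge or by a diagonal of T.
  Joined : ℕ → ℕ → Set
  Joined a x = suc a ≡ x ⊎ T (diag a x) ≡ true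

  HasLeft-mirror : ∀ {p} → p < n → HasLeft p → HasLeft (p + n)
  HasLeft-mirror {p} p<n Tp = subst HasLeft (bar-low p<n) (IsCSPT-symmetric isT (left p) Tp)

  diag-sorted : ∀ {s t} → T (diag s t) ≡ true → s ≤ t
  diag-sorted {s} {t} Tst = <⇒≤ (proj₁ (IsCSPT-valid isT (diag s t) Tst))

  diag-not-long : ∀ {s t} → T (diag s t) ≡ true → t ≢ s + n
  diag-not-long Tst = ValidDiag.b≢a+n (Valid⇒ValidDiag (IsCSPT-valid isT _ Tst))

  diag-avoids-left : ∀ {s t y} → T (diag s t) ≡ true → HasLeft y → ¬ InShortArc n s t y
  diag-avoids-left {s} {t} {y} Tst Ty arc =
    IsCSPT-noncrossing isT (diag s t) (left y) Tst Ty (InShortArc⇒InShort (diag-sorted Tst) arc)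

  ¬diag-exits-above : ∀ {a b s t} → HasLeft a → HasLeft b → T (diag s t) ≡ true → a < s → s < b → b < t → ⊥
  ¬diag-exits-above Ta Tb Tst a<s s<b b<t =
    [ diag-avoids-left Tst Ta , diag-avoids-left Tst Tb ]′ (InShortArc-separating-above (diag-not-long Tst) a<s s<b b<t)

  ¬diag-exits-below : ∀ {a b s t} → HasLeft a → HasLeft b → T (diag s t) ≡ true → s < a → a < t → t < b → ⊥
  ¬diag-exits-below Ta Tb Tst s<a a<t t<b =
    [ diag-avoids-left Tst Ta , diag-avoids-left Tst Tb ]′ (InShortArc-separating-below (diag-not-long Tst) s<a a<t t<b)

  data CrosserInside (a b u v : ℕ) : Chord → Set where
    left-inside : ∀ {y} → u < y → y < v → CrosserInside a b u v (left y)
    diag-inside : ∀ {s t} → T (diag s t) ≡ true → a ≤ s → t ≤ b → Interleaved u v s t →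
                  CrosserInside a b u v (diag s t)

  crosser-inside : ∀ {a b u v h} → HasLeft a → HasLeft b → b ≤ a + n → a ≤ u → u < v → v ≤ b → v < u + n →
                   T h ≡ true → Crosses n (diag u v) h → CrosserInside a b u v h
  crosser-inside {a} {b} {u} {v} {diag s t} Ta Tb _ a≤u _ v≤b _ Th (inj₁ (u<s , s<v , v<t)) with <-≤-connex b t
  ... | inj₁ b<t = ⊥-elim (¬diag-exits-above Ta Tb Th (≤-<-trans a≤u u<s) (<-≤-trans s<v v≤b) b<t)
  ... | inj₂ t≤b = diag-inside Th (≤-trans a≤u (<⇒≤ u<s)) t≤b (inj₁ (u<s , s<v , v<t))
  crosser-inside {a} {b} {u} {v} {diag s t} Ta Tb _ a≤u _ v≤b _ Th (inj₂ (s<u , u<t , t<v)) with <-≤-connex s a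
  ... | inj₁ s<a = ⊥-elim (¬diag-exits-below Ta Tb Th s<a (≤-<-trans a≤u u<t) (<-≤-trans t<v v≤b))
  ... | inj₂ a≤s = diag-inside Th a≤s (≤-trans (<⇒≤ t<v) v≤b) (inj₂ (s<u , u<t , t<v))
  crosser-inside {u = u} {v} {left y} _ _ _ _ u<v _ v<u+n _ x with InShort⇒InShortArc (<⇒≤ u<v) x
  ... | inj₁ (_ , u<y , y<v) = left-inside u<y y<v
  ... | inj₂ (u+n<v , _) = ⊥-elim (<-asym u+n<v v<u+n)
  crosser-inside {a} {b} {u} {v} {right y} Ta _ b≤a+n a≤u u<v v≤b v<u+n Th x with InShort⇒InShortArc (<⇒≤ u<v) x
  ... | inj₁ (_ , u<y , y<v) =
        ⊥-elim (IsCSPT-noncrossing isT (left a) (right y) Ta Th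
                  (inj₁ (≤-<-trans a≤u u<y , <-≤-trans y<v (≤-trans v≤b b≤a+n))))
  ... | inj₂ (u+n<v , _) = ⊥-elim (<-asym u+n<v v<u+n)

  closing-diag : ∀ {a b} → HasLeft a → HasLeft b → a + 2 ≤ b → b < a + n → b < n + n → NoLeftBetween a b →
                 T (diag a b) ≡ true
  closing-diag {a} {b} Ta Tb a+2≤b b<a+n b<2n none with T (diag a b) in Tab
  ... | true = refl
  ... | false with IsCSPT-maximal isT (diag a b) (Valid-short a+2≤b b<a+n b<2n) Tab
  ...   | h , Th , x
    with crosser-inside Ta Tb (<⇒≤ b<a+n) ≤-refl (<-≤-trans (m<m+n a (s≤s z≤n)) a+2≤b) ≤-refl b<a+n Th x
  ...     | left-inside a<y y<b = ⊥-elim (not-¬ Th (none _ a<y y<b))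
  ...     | diag-inside _ _ t≤b (inj₁ (_ , _ , b<t)) = ⊥-elim (<⇒≱ b<t t≤b)
  ...     | diag-inside _ a≤s _ (inj₂ (s<a , _ , _)) = ⊥-elim (<⇒≱ s<a a≤s)

  -- Between consecutive left chords a^L and b^L, the chords of T cut out a triangle a x b.
  record Apex (a b : ℕ) : Set where
    constructor apex
    field
      x        : ℕ
      a<x      : a < x
      x<b      : x < b
      joined-a : Joined a x
      joined-b : Joined x b

  private
    apex-fuel : ∀ {a b} → HasLeft a → HasLeft b → b ≤ a + n → b < n + n → NoLeftBetween a b →
                ∀ k x → b ≤ x + k → a < x → x < b → Joined a x → Apex a b
    apex-fuel {a} {b} _ _ _ _ _ zero x b≤x _ x<b _ = ⊥-elim (<⇒≱ x<b (subst (b ≤_) (+-identityʳ x) b≤x))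
    apex-fuel {a} {b} Ta Tb b≤a+n b<2n none (suc k) x b≤x+k a<x x<b jax with m≤n⇒m<n∨m≡n x<b
    ... | inj₂ 1+x≡b = apex x a<x x<b jax (inj₁ 1+x≡b)
    ... | inj₁ 1+x<b with T (diag x b) in Txb
    ...   | true = apex x a<x x<b jax (inj₂ Txb)
    ...   | false with IsCSPT-maximal isT (diag x b) (Valid-short (subst (_≤ b) (+-comm 2 x) 1+x<b) b<x+n b<2n) Txb
      where
      b<x+n : b < x + n
      b<x+n = ≤-<-trans b≤a+n (+-monoˡ-< n a<x)
    ...     | h , Th , cr with crosser-inside Ta Tb b≤a+n (<⇒≤ a<x) x<b ≤-refl (≤-<-trans b≤a+n (+-monoˡ-< n a<x)) Th cr
    ...       | left-inside x<y y<b = ⊥-elim (not-¬ Th (none _ (<-trans a<x x<y) y<b))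
    ...       | diag-inside _ _ t≤b (inj₁ (_ , _ , b<t)) = ⊥-elim (<⇒≱ b<t t≤b)
    ...       | diag-inside {s} {t} Tst a≤s _ (inj₂ (s<x , x<t , t<b)) with m≤n⇒m<n∨m≡n a≤s
    ...         | inj₂ refl = apex-fuel Ta Tb b≤a+n b<2n none k t b≤t+k (<-trans a<x x<t) t<b (inj₂ Tst)
      where
      b≤t+k : b ≤ t + k
      b≤t+k = ≤-trans b≤x+k (subst (_≤ t + k) (sym (+-suc x k)) (+-monoˡ-≤ k x<t))
    ...         | inj₁ a<s with jax
    ...           | inj₁ refl = ⊥-elim (<⇒≱ a<s (≤-pred s<x))
    ...           | inj₂ Tax = ⊥-elim (IsCSPT-noncrossing isT (diag a x) (diag s t) Tax Tst (inj₁ (a<s , s<x , x<t)))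

  find-apex : ∀ {a b} → HasLeft a → HasLeft b → a + 2 ≤ b → b ≤ a + n → b < n + n → NoLeftBetween a b → Apex a b
  find-apex {a} {b} Ta Tb a+2≤b b≤a+n b<2n none =
    apex-fuel Ta Tb b≤a+n b<2n none b (suc a) (m≤n+m b (suc a)) (n<1+n a) (subst (_≤ b) (+-comm a 2) a+2≤b) (inj₁ refl)

  apex-crossers : ∀ {a b} → HasLeft a → HasLeft b → b ≤ a + n → (A : Apex a b) →
                  ∀ h → T h ≡ true → Crosses n (left (Apex.x A)) h → h ≡ diag a b ⊎ h ≡ right b
  apex-crossers Ta Tb b≤a+n A (left y) Th ()
  apex-crossers {a} {b} Ta Tb b≤a+n (apex x a<x x<b jax jxb) (diag s t) Th cr with InShort⇒InShortArc (diag-sorted Th) cr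
  ... | inj₂ (wide , inj₁ x<s) = ⊥-elim (diag-avoids-left Th Ta (inj₂ (wide , inj₁ (<-trans a<x x<s))))
  ... | inj₂ (wide , inj₂ t<x) = ⊥-elim (diag-avoids-left Th Tb (inj₂ (wide , inj₂ (<-trans t<x x<b))))
  ... | inj₁ (short , s<x , x<t) with <-≤-connex s a | <-≤-connex b t
  ...   | inj₁ s<a | _ = ⊥-elim (diag-avoids-left Th Ta (inj₁ (short , s<a , <-trans a<x x<t)))
  ...   | inj₂ _ | inj₁ b<t = ⊥-elim (diag-avoids-left Th Tb (inj₁ (short , <-trans s<x x<b , b<t)))
  ...   | inj₂ a≤s | inj₂ t≤b with m≤n⇒m<n∨m≡n a≤s | m≤n⇒m<n∨m≡n t≤b
  ...     | inj₂ refl | inj₂ refl = inj₁ refl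
  ...     | inj₁ a<s | _ =
    [ (λ { refl → ⊥-elim (<⇒≱ a<s (≤-pred s<x)) })
    , (λ Tax → ⊥-elim (IsCSPT-noncrossing isT (diag a x) (diag s t) Tax Th (inj₁ (a<s , s<x , x<t)))) ]′ jax
  ...     | inj₂ refl | inj₁ t<b =
    [ (λ { refl → ⊥-elim (<⇒≱ t<b x<t) })
    , (λ Txb → ⊥-elim (IsCSPT-noncrossing isT (diag x b) (diag a t) Txb Th (inj₂ (a<x , x<t , t<b)))) ]′ jxb
  apex-crossers {a} {b} Ta Tb b≤a+n (apex x a<x x<b _ _) (right y) Th (inj₂ y+n<x) =
    ⊥-elim (IsCSPT-noncrossing isT (left b) (right y) Tb Th (inj₂ (<-trans y+n<x x<b)))
  apex-crossers {a} {b} Ta Tb b≤a+n (apex x a<x x<b _ _) (right y) Th (inj₁ (x<y , y<x+n)) with <-≤-connex y (a + n) | <-cmp b y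
  ... | inj₁ y<a+n | _ = ⊥-elim (IsCSPT-noncrossing isT (left a) (right y) Ta Th (inj₁ (<-trans a<x x<y , y<a+n)))
  ... | inj₂ _ | tri< b<y _ _ =
    ⊥-elim (IsCSPT-noncrossing isT (left b) (right y) Tb Th (inj₁ (b<y , <-trans y<x+n (+-monoˡ-< n x<b))))
  ... | inj₂ _ | tri≈ _ refl _ = inj₂ refl
  ... | inj₂ a+n≤y | tri> _ _ y<b = ⊥-elim (<⇒≱ y<b (≤-trans b≤a+n a+n≤y))

bar-≢-above : ∀ n {x y} → x < y → y < x + n → y ≢ bar n x
bar-≢-above n {x} {y} x<y y<x+n e with barView n x
... | low _ e′ = <-irrefl (trans e e′) y<x+n
... | high k refl e′ = <-irrefl (sym (trans e e′)) (≤-<-trans (m≤m+n k n) x<y)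

bar-≢-below : ∀ n {x y} → y < x → x < y + n → y ≢ bar n x
bar-≢-below n {x} {y} y<x x<y+n e with barView n x
... | low _ e′ = <-irrefl (trans e e′) (<-≤-trans y<x (m≤m+n x n))
... | high k refl e′ = <-irrefl (cong (_+ n) (sym (trans e e′))) x<y+n

csym-diag-endpoints : ∀ n {a b c d} → csym n (diag a b) ≡ diag c d →
  (c ≡ bar n a ⊎ c ≡ bar n b) × (d ≡ bar n a ⊎ d ≡ bar n b)
csym-diag-endpoints n {a} {b} e with diag-injective e
... | refl , refl = ⊓-sel (bar n a) (bar n b) , ⊔-sel (bar n a) (bar n b)

csym-short-diag-disjoint : ∀ n {a b} → 0 < n → a < b → b < a + n → b < n + n →
  ∀ {c d} → csym n (diag a b) ≡ diag c d → c ≢ a × c ≢ b × d ≢ a × d ≢ b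
csym-short-diag-disjoint n {a} {b} 0<n a<b b<a+n b<2n e with csym-diag-endpoints n e
... | c∈ , d∈ = avoid c∈ , avoid′ c∈ , avoid d∈ , avoid′ d∈
  where
  a≢bar-b : a ≢ bar n b
  a≢bar-b = bar-≢-below n a<b b<a+n
  avoid : ∀ {z} → z ≡ bar n a ⊎ z ≡ bar n b → z ≢ a
  avoid (inj₁ refl) e′ = bar-≢ {n} 0<n e′
  avoid (inj₂ refl) e′ = a≢bar-b (sym e′)
  avoid′ : ∀ {z} → z ≡ bar n a ⊎ z ≡ bar n b → z ≢ b
  avoid′ (inj₁ refl) e′ = bar-≢-above n a<b b<a+n (sym e′)
  avoid′ (inj₂ refl) e′ = bar-≢ {n} 0<n e′

-- Flips changing the number of left pairs

module Increase (n : ℕ) {T : ChordSet} (isT : IsCSPT n T) where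
  open Geometry n isT

  LeftIncrease : Set
  LeftIncrease = ∃ λ U → Flip n T U × leftPairs n U ≡ suc (leftPairs n T)

  module _ {a b} (Ta : HasLeft a) (Tb : HasLeft b) (a+2≤b : a + 2 ≤ b) (b<2n : b < n + n)
           (none : NoLeftBetween a b) (A : Apex a b) where
    open Apex A

    private
      0<n : b ≤ a + n → 0 < n
      0<n b≤a+n = ≤-trans (s≤s z≤n) (+-cancelˡ-≤ a 2 n (≤-trans a+2≤b b≤a+n))

      vx : Valid n (left x)
      vx = <-trans x<b b<2n

      Tx : T (left x) ≡ false
      Tx = none x a<x x<b

      side-crossing : b ≤ a + n → ∀ {y} → a < y → y < b → y ≢ x →
                      ∃ λ k → T k ≡ true × (k ≡ diag a x ⊎ k ≡ diag x b) × Crosses n (left y) k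
      side-crossing b≤a+n {y} a<y y<b y≢x with <-cmp y x
      ... | tri≈ _ y≡x _ = ⊥-elim (y≢x y≡x)
      ... | tri< y<x _ _ = [ (λ 1+a≡x → ⊥-elim (<⇒≱ a<y (≤-pred (subst (suc y ≤_) (sym 1+a≡x) y<x))))
                           , (λ Tax → diag a x , Tax , inj₁ refl ,
                                      InShortArc⇒InShort (<⇒≤ a<x) (inj₁ (<-≤-trans x<b b≤a+n , a<y , y<x))) ]′ joined-a
      ... | tri> _ _ x<y = [ (λ 1+x≡b → ⊥-elim (<⇒≱ y<b (subst (_≤ y) 1+x≡b x<y)))
                           , (λ Txb → diag x b , Txb , inj₂ refl , InShortArc⇒InShort (<⇒≤ x<b)
                                        (inj₁ (≤-<-trans b≤a+n (+-monoˡ-< n a<x) , x<y , y<b))) ]′ joined-b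

    flip-in-apex : ∀ {g} (Tg : T g ≡ true) → b ≤ a + n →
      (let open Replace n isT Tg vx Tx in
        (∀ h → T h ≡ true → Crosses n (left x) h → h ≡ g ⊎ h ≡ ḡ) →
        Crosses n g (left x) →
        (∀ {k} → k ≡ diag a x ⊎ k ≡ diag x b → k ≢ g × k ≢ ḡ) →
        (∀ s t → Valid n (diag s t) → T′ (diag s t) ≡ false → Crosses n (diag s t) g →
                 CrossedIn n T′ (diag s t)) →
        (∀ y → y < n + n → Crosses n (right y) g → CrossedIn n T′ (right y)) →
        (∀ {y} → y < n + n → Crosses n (left y) g → a < y × y < b) →
        (∀ y → left y ≢ g × left y ≢ ḡ) →
        LeftIncrease)
    flip-in-apex {g} Tg b≤a+n only-g g×x sides-kept diag-blocked right-blocked left-crossers-inside g-not-left =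
      T′ , flip , count
      where
      open Replace n isT Tg vx Tx
      blocked : ∀ e → Valid n e → T′ e ≡ false → Crosses n e g → CrossedIn n T′ e
      blocked (diag s t) ve T′e cr = diag-blocked s t ve T′e cr
      blocked (right y) ve T′e cr = right-blocked y ve cr
      blocked (left y) ve T′e cr with left-crossers-inside ve cr | toSum (y ≟ x)
      ... | _ | inj₁ refl = ⊥-elim (not-¬ T′-d T′e)
      ... | a<y , y<b | inj₂ y≢x with side-crossing b≤a+n a<y y<b y≢x
      ...   | k , Tk , side , crk = k , T′-kept k Tk (proj₁ (sides-kept side)) (proj₂ (sides-kept side)) , crk
      open Flip-of only-g (inj₁ g×x) blocked
      count : leftPairs n T′ ≡ suc (leftPairs n T)
      count = centralPairs-insert L n T T′ vx Tx (IsCSPT-symmetric-false isT (left x) vx Tx) T′-d T′-d̄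
                (λ y y≢x y≢x̄ → T′-other (left y) (proj₁ (g-not-left y)) (proj₂ (g-not-left y))
                                         (y≢x ∘′ left-injective) (y≢x̄ ∘′ left-injective))

    private
      left-kept : ∀ {g} (Tg : T g ≡ true) → (∀ y → left y ≢ g × left y ≢ csym n g) → ∀ y → HasLeft y →
                  Replace.T′ n isT Tg vx Tx (left y) ≡ true
      left-kept Tg not-g y Ty = Replace.T′-kept n isT Tg vx Tx (left y) Ty (proj₁ (not-g y)) (proj₂ (not-g y))

    short-flip : b < a + n → LeftIncrease
    short-flip b<a+n =
      flip-in-apex Tab (<⇒≤ b<a+n) only-ab ab×x sides-kept diag-blocked right-blocked left-crossers-inside not-left
      where
      a<b = <-trans a<x x<b
      Tab = closing-diag Ta Tb a+2≤b b<a+n b<2n none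
      open Replace n isT Tab vx Tx using (T′)
      not-left : ∀ y → left y ≢ diag a b × left y ≢ csym n (diag a b)
      not-left y = (λ ()) , (λ ())
      only-ab : ∀ h → T h ≡ true → Crosses n (left x) h → h ≡ diag a b ⊎ h ≡ csym n (diag a b)
      only-ab h Th cr with apex-crossers Ta Tb (<⇒≤ b<a+n) A h Th cr
      ... | inj₁ e = inj₁ e
      ... | inj₂ refl = ⊥-elim (IsCSPT-noncrossing isT (left a) (right b) Ta Th (inj₁ (a<b , b<a+n)))
      ab×x : Crosses n (diag a b) (left x)
      ab×x = InShortArc⇒InShort (<⇒≤ a<b) (inj₁ (b<a+n , a<x , x<b))
      mirror = csym-short-diag-disjoint n (0<n (<⇒≤ b<a+n)) a<b b<a+n b<2n
      sides-kept : ∀ {k} → k ≡ diag a x ⊎ k ≡ diag x b → k ≢ diag a b × k ≢ csym n (diag a b)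
      sides-kept (inj₁ refl) = (λ e → <-irrefl (proj₂ (diag-injective e)) x<b) , (λ e → proj₁ (mirror (sym e)) refl)
      sides-kept (inj₂ refl) = (λ e → <-irrefl (sym (proj₁ (diag-injective e))) a<x)
                             , (λ e → proj₂ (proj₂ (proj₂ (mirror (sym e)))) refl)
      diag-blocked : ∀ s t → Valid n (diag s t) → T′ (diag s t) ≡ false → Crosses n (diag s t) (diag a b) →
                     CrossedIn n T′ (diag s t)
      diag-blocked s t v _ cr = [ (λ arc → left a , left-kept Tab not-left a Ta , InShortArc⇒InShort s≤t arc)
                                , (λ arc → left b , left-kept Tab not-left b Tb , InShortArc⇒InShort s≤t arc) ]′ (separating cr)
        where
        s≤t = <⇒≤ (proj₁ v)
        t≢s+n = ValidDiag.b≢a+n (Valid⇒ValidDiag v)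
        separating : Interleaved s t a b → InShortArc n s t a ⊎ InShortArc n s t b
        separating (inj₁ (s<a , a<t , t<b)) = InShortArc-separating-below t≢s+n s<a a<t t<b
        separating (inj₂ (a<s , s<b , b<t)) = InShortArc-separating-above t≢s+n a<s s<b b<t
      right-blocked : ∀ y → y < n + n → Crosses n (right y) (diag a b) → CrossedIn n T′ (right y)
      right-blocked y _ cr with InShort⇒InShortArc (<⇒≤ a<b) cr
      ... | inj₁ (_ , a<y , y<b) = left a , left-kept Tab not-left a Ta , inj₁ (a<y , <-trans y<b b<a+n)
      ... | inj₂ (a+n<b , _) = ⊥-elim (<-asym a+n<b b<a+n)
      left-crossers-inside : ∀ {y} → y < n + n → Crosses n (left y) (diag a b) → a < y × y < b
      left-crossers-inside _ cr with InShort⇒InShortArc (<⇒≤ a<b) cr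
      ... | inj₁ (_ , a<y , y<b) = a<y , y<b
      ... | inj₂ (a+n<b , _) = ⊥-elim (<-asym a+n<b b<a+n)

    long-flip : b ≡ a + n → LeftIncrease
    long-flip refl =
      flip-in-apex Tb̂ ≤-refl only-b̂ b̂×x (λ { (inj₁ refl) → (λ ()) , (λ ()) ; (inj₂ refl) → (λ ()) , (λ ()) })
                   diag-blocked (λ _ _ ()) left-crossers-inside (λ y → (λ ()) , (λ ()))
      where
      ¬Tab : T (diag a b) ≢ true
      ¬Tab Tab = diag-not-long Tab refl
      Tb̂ : T (right b) ≡ true
      Tb̂ with IsCSPT-maximal isT (left x) vx Tx
      ... | h , Th , cr with apex-crossers Ta Tb ≤-refl A h Th cr
      ...   | inj₁ refl = ⊥-elim (¬Tab Th)
      ...   | inj₂ refl = Th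
      open Replace n isT Tb̂ vx Tx using (T′)
      only-b̂ : ∀ h → T h ≡ true → Crosses n (left x) h → h ≡ right b ⊎ h ≡ csym n (right b)
      only-b̂ h Th cr with apex-crossers Ta Tb ≤-refl A h Th cr
      ... | inj₁ refl = ⊥-elim (¬Tab Th)
      ... | inj₂ e = inj₁ e
      b̂×x : Crosses n (right b) (left x)
      b̂×x = inj₁ (x<b , +-monoˡ-< n a<x)
      diag-blocked : ∀ s t → Valid n (diag s t) → T′ (diag s t) ≡ false → Crosses n (diag s t) (right b) →
                     CrossedIn n T′ (diag s t)
      diag-blocked s t _ _ cr = left b , left-kept Tb̂ (λ y → (λ ()) , (λ ())) b Tb , cr
      left-crossers-inside : ∀ {y} → y < n + n → Crosses n (left y) (right b) → a < y × y < b
      left-crossers-inside _ (inj₁ (y<b , b<y+n)) = +-cancelʳ-< n a _ b<y+n , y<b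
      left-crossers-inside y<2n (inj₂ b+n<y) = ⊥-elim (<-asym b+n<y (<-≤-trans y<2n (+-monoˡ-≤ n (m≤n+m n a))))

  flip-between : ∀ {a b} → HasLeft a → HasLeft b → a + 2 ≤ b → b ≤ a + n → b < n + n → NoLeftBetween a b →
                 LeftIncrease
  flip-between Ta Tb a+2≤b b≤a+n b<2n none with m≤n⇒m<n∨m≡n b≤a+n
  ... | inj₁ b<a+n = short-flip Ta Tb a+2≤b b<2n none (find-apex Ta Tb a+2≤b b≤a+n b<2n none) b<a+n
  ... | inj₂ b≡a+n = long-flip Ta Tb a+2≤b b<2n none (find-apex Ta Tb a+2≤b b≤a+n b<2n none) b≡a+n

  -- A missing z^L (a missing y^L or its mirror) lies in the open half circle after a present p^L;
  -- the nearest present left chords a < z < b then satisfy b ≤ p + n ≤ a + n because p̄^L is present.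
  left-increase : 1 ≤ leftPairs n T → leftPairs n T < n → LeftIncrease
  left-increase some not-all with countBelow-witness leftIn n some | countBelow-witness-false leftIn n not-all
  ... | p , p<n , Tp | y , y<n , Ty = go missing
    where
    p+n<2n : p + n < n + n
    p+n<2n = +-monoˡ-< n p<n
    Missing : Set
    Missing = ∃ λ z → p < z × z < p + n × T (left z) ≡ false
    missing : Missing
    missing with <-cmp p y
    ... | tri< p<y _ _ = y , p<y , <-≤-trans y<n (m≤n+m n p) , Ty
    ... | tri≈ _ refl _ = ⊥-elim (not-¬ Tp Ty)
    ... | tri> _ _ y<p = y + n , <-≤-trans p<n (m≤n+m n y) , +-monoˡ-< n y<p ,
          subst (λ z → T (left z) ≡ false) (bar-low y<n) (IsCSPT-symmetric-false isT (left y) (<-≤-trans y<n (m≤m+n n n)) Ty)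
    go : Missing → LeftIncrease
    go (z , p<z , z<p+n , Tz) with prevTrue leftIn p z p<z Tp | nextTrue leftIn z (p + n) z<p+n (HasLeft-mirror p<n Tp)
    ... | a , p≤a , a<z , Ta , none-az | b , z<b , b≤p+n , Tb , none-zb =
      flip-between Ta Tb (subst (_≤ b) (+-comm 2 a) (≤-trans (s≤s a<z) z<b)) (≤-trans b≤p+n (+-monoˡ-≤ n p≤a))
                   (≤-<-trans b≤p+n p+n<2n) none-ab
      where
      none-ab : NoLeftBetween a b
      none-ab w a<w w<b with <-cmp w z
      ... | tri< w<z _ _ = none-az w a<w w<z
      ... | tri≈ _ refl _ = Tz
      ... | tri> _ _ z<w = none-zb w z<w w<b

module Decrease (n : ℕ) {T : ChordSet} (isT : IsCSPT n T) where
  open Geometry n isT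

  LeftDecrease : Set
  LeftDecrease = ∃ λ U → Flip n T U × leftPairs n T ≡ suc (leftPairs n U)

  module _ {a b c} (Ta : HasLeft a) (Tb : HasLeft b) (Tc : HasLeft c) (a<b : a < b) (b<c : b < c)
           (c≤a+n : c ≤ a + n) (c<2n : c < n + n) (none-ab : NoLeftBetween a b) (none-bc : NoLeftBetween b c) where

    private
      b<2n : b < n + n
      b<2n = <-trans b<c c<2n
      b<a+n : b < a + n
      b<a+n = <-≤-trans b<c c≤a+n
      c<b+n : c < b + n
      c<b+n = ≤-<-trans c≤a+n (+-monoˡ-< n a<b)

      joined-ab : Joined a b
      joined-ab with m≤n⇒m<n∨m≡n a<b
      ... | inj₂ e = inj₁ e
      ... | inj₁ a+1<b = inj₂ (closing-diag Ta Tb (subst (_≤ b) (+-comm 2 a) a+1<b) b<a+n b<2n none-ab)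

      joined-bc : Joined b c
      joined-bc with m≤n⇒m<n∨m≡n b<c
      ... | inj₂ e = inj₁ e
      ... | inj₁ b+1<c = inj₂ (closing-diag Tb Tc (subst (_≤ c) (+-comm 2 b) b+1<c) c<b+n c<2n none-bc)

      a-not-b : left a ≢ left b × left a ≢ left (bar n b)
      a-not-b = (λ e → <-irrefl (left-injective e) a<b) , (λ e → bar-≢-below n a<b b<a+n (left-injective e))

      c-not-b : left c ≢ left b × left c ≢ left (bar n b)
      c-not-b = (λ e → <-irrefl (sym (left-injective e)) b<c) , (λ e → bar-≢-above n b<c c<b+n (left-injective e))

      Blocker : Chord → Set
      Blocker e = ∃ λ k → T k ≡ true × k ≢ left b × k ≢ left (bar n b) × Crosses n e k

      by-a : ∀ {e} → Crosses n e (left a) → Blocker e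
      by-a cr = left a , Ta , proj₁ a-not-b , proj₂ a-not-b , cr

      by-c : ∀ {e} → Crosses n e (left c) → Blocker e
      by-c cr = left c , Tc , proj₁ c-not-b , proj₂ c-not-b , cr

    diag-crossing-b : ∀ {s t} → s ≤ t → InShort n s t b → Blocker (diag s t) ⊎ (s ≡ a × t ≡ c)
    diag-crossing-b {s} {t} s≤t cr with InShort⇒InShortArc s≤t cr
    ... | inj₂ (wide , inj₁ b<s) = inj₁ (by-a (InShortArc⇒InShort s≤t (inj₂ (wide , inj₁ (<-trans a<b b<s)))))
    ... | inj₂ (wide , inj₂ t<b) = inj₁ (by-c (InShortArc⇒InShort s≤t (inj₂ (wide , inj₂ (<-trans t<b b<c)))))
    ... | inj₁ (short , s<b , b<t) with <-≤-connex s a | <-≤-connex c t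
    ...   | inj₁ s<a | _ = inj₁ (by-a (InShortArc⇒InShort s≤t (inj₁ (short , s<a , <-trans a<b b<t))))
    ...   | inj₂ _ | inj₁ c<t = inj₁ (by-c (InShortArc⇒InShort s≤t (inj₁ (short , <-trans s<b b<c , c<t))))
    ...   | inj₂ a≤s | inj₂ t≤c with m≤n⇒m<n∨m≡n a≤s | m≤n⇒m<n∨m≡n t≤c
    ...     | inj₂ refl | inj₂ refl = inj₂ (refl , refl)
    ...     | inj₁ a<s | _ = [ (λ 1+a≡b → ⊥-elim (<⇒≱ a<s (≤-pred (subst (suc s ≤_) (sym 1+a≡b) s<b))))
                             , (λ Tab → inj₁ (diag a b , Tab , (λ ()) , (λ ()) , inj₂ (a<s , s<b , b<t))) ]′ joined-ab
    ...     | inj₂ refl | inj₁ t<c = [ (λ 1+b≡c → ⊥-elim (<⇒≱ t<c (subst (_≤ t) 1+b≡c b<t)))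
                                     , (λ Tbc → inj₁ (diag b c , Tbc , (λ ()) , (λ ()) , inj₁ (s<b , b<t , t<c))) ]′ joined-bc

    right-crossing-b : ∀ {y} → CCW n b y → Blocker (right y) ⊎ (y ≡ c × c ≡ a + n)
    right-crossing-b (inj₂ y+n<b) = inj₁ (by-c (inj₂ (<-trans y+n<b b<c)))
    right-crossing-b {y} (inj₁ (b<y , y<b+n)) with <-≤-connex y (a + n) | <-cmp c y
    ... | inj₁ y<a+n | _ = inj₁ (by-a (inj₁ (<-trans a<b b<y , y<a+n)))
    ... | inj₂ _ | tri< c<y _ _ = inj₁ (by-c (inj₁ (c<y , <-trans y<b+n (+-monoˡ-< n b<c))))
    ... | inj₂ a+n≤y | tri≈ _ refl _ = inj₂ (refl , ≤-antisym c≤a+n a+n≤y)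
    ... | inj₂ a+n≤y | tri> _ _ y<c = ⊥-elim (<⇒≱ y<c (≤-trans c≤a+n a+n≤y))

    private
      vb : Valid n (left b)
      vb = b<2n

    flip-out-b : ∀ {d} (vd : Valid n d) (Td : T d ≡ false) →
      (let open Replace n isT Tb vd Td in
        (∀ h → T h ≡ true → Crosses n d h → h ≡ left b ⊎ h ≡ csym n (left b)) →
        Crosses n (left b) d →
        (Valid n (diag a c) → T′ (diag a c) ≢ false) →
        (c ≡ a + n → T′ (right c) ≢ false) →
        (∀ y → left y ≢ d × left y ≢ d̄) →
        LeftDecrease)
    flip-out-b {d} vd Td only-b b×d ac-kept c̄-kept d-not-left = T′ , flip , count
      where
      open Replace n isT Tb vd Td
      blocked : ∀ e → Valid n e → T′ e ≡ false → Crosses n e (left b) → CrossedIn n T′ e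
      blocked (diag s t) ve T′e cr with diag-crossing-b (<⇒≤ (proj₁ ve)) cr
      ... | inj₁ (k , Tk , k≢b , k≢b̄ , crk) = k , T′-kept k Tk k≢b k≢b̄ , crk
      ... | inj₂ (refl , refl) = ⊥-elim (ac-kept ve T′e)
      blocked (right y) ve T′e cr with right-crossing-b cr
      ... | inj₁ (k , Tk , k≢b , k≢b̄ , crk) = k , T′-kept k Tk k≢b k≢b̄ , crk
      ... | inj₂ (refl , c≡a+n) = ⊥-elim (c̄-kept c≡a+n T′e)
      open Flip-of only-b (inj₁ b×d) blocked
      count : leftPairs n T ≡ suc (leftPairs n T′)
      count = centralPairs-insert L n T′ T vb T′-g T′-ḡ Tb (IsCSPT-symmetric isT (left b) Tb)
                (λ y y≢b y≢b̄ → sym (T′-other (left y) (y≢b ∘′ left-injective) (y≢b̄ ∘′ left-injective)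
                                               (proj₁ (d-not-left y)) (proj₂ (d-not-left y))))

    short-flip : c < a + n → LeftDecrease
    short-flip c<a+n = flip-out-b vac Tac only-b b×ac (λ _ T′ac → not-¬ T′-d T′ac) (λ c≡a+n _ → <-irrefl c≡a+n c<a+n)
                                  (λ y → (λ ()) , (λ ()))
      where
      a<c = <-trans a<b b<c
      vac : Valid n (diag a c)
      vac = Valid-short (subst (_≤ c) (+-comm 2 a) (≤-<-trans a<b b<c)) c<a+n c<2n
      b×ac : Crosses n (left b) (diag a c)
      b×ac = InShortArc⇒InShort (<⇒≤ a<c) (inj₁ (c<a+n , a<b , b<c))
      Tac : T (diag a c) ≡ false
      Tac with T (diag a c) in eq
      ... | false = refl
      ... | true = ⊥-elim (IsCSPT-noncrossing isT (diag a c) (left b) eq Tb b×ac)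
      open Replace n isT Tb vac Tac using (T′-d)
      only-b : ∀ h → T h ≡ true → Crosses n (diag a c) h → h ≡ left b ⊎ h ≡ csym n (left b)
      only-b h Th cr with crosser-inside Ta Tc c≤a+n ≤-refl a<c ≤-refl c<a+n Th cr
      ... | diag-inside _ _ t≤c (inj₁ (_ , _ , c<t)) = ⊥-elim (<⇒≱ c<t t≤c)
      ... | diag-inside _ a≤s _ (inj₂ (s<a , _ , _)) = ⊥-elim (<⇒≱ s<a a≤s)
      ... | left-inside {y} a<y y<c with <-cmp y b
      ...   | tri< y<b _ _ = ⊥-elim (not-¬ Th (none-ab y a<y y<b))
      ...   | tri≈ _ refl _ = inj₁ refl
      ...   | tri> _ _ b<y = ⊥-elim (not-¬ Th (none-bc y b<y y<c))

    long-flip : c ≡ a + n → LeftDecrease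
    long-flip c≡a+n = flip-out-b c<2n Tĉ only-b b×ĉ (λ vac _ → ValidDiag.b≢a+n (Valid⇒ValidDiag vac) c≡a+n)
                                 (λ _ T′ĉ → not-¬ T′-d T′ĉ) (λ y → (λ ()) , (λ ()))
      where
      b×ĉ : Crosses n (left b) (right c)
      b×ĉ = inj₁ (b<c , c<b+n)
      Tĉ : T (right c) ≡ false
      Tĉ with T (right c) in eq
      ... | false = refl
      ... | true = ⊥-elim (IsCSPT-noncrossing isT (left b) (right c) Tb eq b×ĉ)
      open Replace n isT Tb c<2n Tĉ using (T′-d)
      only-b : ∀ h → T h ≡ true → Crosses n (right c) h → h ≡ left b ⊎ h ≡ csym n (left b)
      only-b (right y) Th ()
      only-b (diag s t) Th cr = ⊥-elim (IsCSPT-noncrossing isT (left c) (diag s t) Tc Th cr)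
      only-b (left y) Th (inj₂ c+n<y) =
        ⊥-elim (<-asym c+n<y (<-≤-trans (IsCSPT-valid isT (left y) Th)
                                        (subst (λ z → n + n ≤ z + n) (sym c≡a+n) (+-monoˡ-≤ n (m≤n+m n a)))))
      only-b (left y) Th (inj₁ (y<c , c<y+n)) with <-cmp y b
      ... | tri< y<b _ _ = ⊥-elim (not-¬ Th (none-ab y (+-cancelʳ-< n a y (subst (_< y + n) c≡a+n c<y+n)) y<b))
      ... | tri≈ _ refl _ = inj₁ refl
      ... | tri> _ _ b<y = ⊥-elim (not-¬ Th (none-bc y b<y y<c))

  flip-out-middle : ∀ {a b c} → HasLeft a → HasLeft b → HasLeft c → a < b → b < c → c ≤ a + n → c < n + n →
                    NoLeftBetween a b → NoLeftBetween b c → LeftDecrease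
  flip-out-middle Ta Tb Tc a<b b<c c≤a+n c<2n none-ab none-bc with m≤n⇒m<n∨m≡n c≤a+n
  ... | inj₁ c<a+n = short-flip Ta Tb Tc a<b b<c c≤a+n c<2n none-ab none-bc c<a+n
  ... | inj₂ c≡a+n = long-flip Ta Tb Tc a<b b<c c≤a+n c<2n none-ab none-bc c≡a+n

  -- b and c are the next present left chords after p; c ≤ p + n because p̄^L is present.
  flip-out-after : ∀ {p q} → p < n → q < n → p < q → HasLeft p → HasLeft q → LeftDecrease
  flip-out-after {p} {q} p<n q<n p<q Tp Tq with nextTrue leftIn p q p<q Tq
  ... | b , p<b , b≤q , Tb , none-pb
    with nextTrue leftIn b (p + n) (≤-<-trans b≤q (<-≤-trans q<n (m≤n+m n p)))
                  (HasLeft-mirror p<n Tp)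
  ...   | c , b<c , c≤p+n , Tc , none-bc =
          flip-out-middle Tp Tb Tc p<b b<c c≤p+n (≤-<-trans c≤p+n (+-monoˡ-< n p<n)) none-pb none-bc

  left-decrease : 2 ≤ leftPairs n T → LeftDecrease
  left-decrease two with countBelow-two-witnesses leftIn n two
  ... | p , q , p<n , q<n , p≢q , Tp , Tq with <-cmp p q
  ...   | tri< p<q _ _ = flip-out-after p<n q<n p<q Tp Tq
  ...   | tri≈ _ p≡q _ = ⊥-elim (p≢q p≡q)
  ...   | tri> _ _ q<p = flip-out-after q<n p<n q<p Tq Tp

-- Left and right pairs

<ᵇ-true : ∀ {y m} → y < m → (y <ᵇ m) ≡ true
<ᵇ-true {y} {m} y<m with y <ᵇ m | <ᵇ-reflects-< y m
... | true | _ = refl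
... | false | ofⁿ y≮m = ⊥-elim (y≮m y<m)

<ᵇ-false : ∀ {y m} → m ≤ y → (y <ᵇ m) ≡ false
<ᵇ-false {y} {m} m≤y with y <ᵇ m | <ᵇ-reflects-< y m
... | false | _ = refl
... | true | ofʸ y<m = ⊥-elim (<⇒≱ y<m m≤y)

right-crossed-by-left : ∀ {n q} → 2 ≤ n → q < n + n → ∃ λ y → y < n + n × CCW n y q
right-crossed-by-left {n} {zero} 2≤n _ = suc n , subst (_< n + n) (+-comm n 1) (+-monoʳ-< n 2≤n) , inj₂ (n<1+n n)
right-crossed-by-left {n} {suc q} 2≤n 1+q<2n =
  q , <-trans (n<1+n q) 1+q<2n , inj₁ (n<1+n q , subst (_< q + n) (+-comm q 1) (+-monoʳ-< q 2≤n))

diag-crossed-by-central : ∀ {n a b} → Valid n (diag a b) → ∃ λ p → p < n + n × InShort n a b p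
diag-crossed-by-central {n} {a} {b} v with Valid⇒ValidDiag v
... | mkValidDiag a<b b<2n a+2≤b b≢a+n b+2≤a+2n with <-cmp b (a + n)
...   | tri< b<a+n _ _ = suc a , <-trans a+1<b b<2n , InShortArc⇒InShort (<⇒≤ a<b) (inj₁ (b<a+n , n<1+n a , a+1<b))
  where a+1<b = subst (_≤ b) (+-comm a 2) a+2≤b
...   | tri≈ _ b≡a+n _ = ⊥-elim (b≢a+n b≡a+n)
...   | tri> _ _ a+n<b with a
...     | suc a′ = 0 , ≤-<-trans z≤n b<2n , InShortArc⇒InShort (<⇒≤ a<b) (inj₂ (a+n<b , inj₁ (s≤s z≤n)))
...     | zero =
  suc b , subst (_≤ n + n) (+-comm b 2) b+2≤a+2n , InShortArc⇒InShort (<⇒≤ a<b) (inj₂ (a+n<b , inj₂ (n<1+n b)))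

module _ {n : ℕ} {T : ChordSet} (isT : IsCSPT n T) where
  open Geometry n isT

  T-central-representative : ∀ s {y} → y < n + n → T (central s (representative n y)) ≡ T (central s y)
  T-central-representative s {y} y<2n with representative-cases n y
  ... | inj₁ e = cong (T ∘′ central s) e
  ... | inj₂ e = trans (cong (T ∘′ central s) e)
                       (trans (cong T (sym (csym-central s n y))) (IsCSPT-csym isT (central s y) (central-valid s y<2n)))

  centralPairs-full : ∀ s → centralPairs s n T ≡ n → ∀ {y} → y < n + n → T (central s y) ≡ true
  centralPairs-full s full y<2n =
    trans (sym (T-central-representative s y<2n)) (countBelow-full _ full _ (representative-< n y<2n))

  centralPairs-empty : ∀ s → centralPairs s n T ≡ 0 → ∀ {y} → y < n + n → T (central s y) ≡ false
  centralPairs-empty s empty {y} y<2n with T (central s y) in eq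
  ... | false = refl
  ... | true = ⊥-elim (<⇒≱ (subst (1 ≤_) empty (countBelow-pos _ (representative-< n y<2n)
                                                   (trans (T-central-representative s y<2n) eq))) ≤-refl)

  left-right-same-index : ∀ {p q} → p < n → q < n → T (left p) ≡ true → T (right q) ≡ true → q ≡ p
  left-right-same-index {p} {q} p<n q<n Tp Tq with <-cmp q p
  ... | tri≈ _ q≡p _ = q≡p
  ... | tri> _ _ p<q = ⊥-elim (IsCSPT-noncrossing isT (left p) (right q) Tp Tq (inj₁ (p<q , <-≤-trans q<n (m≤n+m n p))))
  ... | tri< q<p _ _ =
    ⊥-elim (IsCSPT-noncrossing isT (left (p + n)) (right q) (HasLeft-mirror p<n Tp) Tq (inj₂ (+-monoˡ-< n q<p)))

  rightPairs≤1 : 1 ≤ leftPairs n T → rightPairs n T ≤ 1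
  rightPairs≤1 some-left with rightPairs n T in eq
  ... | zero = z≤n
  ... | suc zero = ≤-refl
  ... | suc (suc _) with countBelow-two-witnesses _ n (subst (2 ≤_) (sym eq) (s≤s (s≤s z≤n)))
                        | countBelow-witness leftIn n some-left
  ...   | q , q′ , q<n , q′<n , q≢q′ , Tq , Tq′ | p , p<n , Tp =
          ⊥-elim (q≢q′ (trans (left-right-same-index p<n q<n Tp Tq) (sym (left-right-same-index p<n q′<n Tp Tq′))))

  private
    only-left-pair : ∀ {p} → leftPairs n T ≡ 1 → p < n → HasLeft p → NoLeftBetween p (p + n)
    only-left-pair {p} one p<n Tp w p<w w<p+n with T (left w) in Tw
    ... | false = refl
    ... | true with representative n w ≟ p
    ...   | no r≢p = ⊥-elim (<⇒≱ (subst (2 ≤_) one (countBelow-two leftIn (representative-< n w<2n) p<n r≢p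
                                                                (trans (T-central-representative L w<2n) Tw) Tp)) ≤-refl)
      where w<2n = <-trans w<p+n (+-monoˡ-< n p<n)
    ...   | yes r≡p with representative-cases n w
    ...     | inj₁ r≡w = ⊥-elim (<-irrefl (trans (sym r≡p) r≡w) p<w)
    ...     | inj₂ r≡w̄ = ⊥-elim (bar-≢-below n p<w w<p+n (trans (sym r≡p) r≡w̄))

  -- With a single left pair {p^L, p̄^L}, the apex x of the triangle between them has x^L crossed by
  -- diag p p̄ or by p̄^R; the former is a long diagonal, so p̄^R ∈ T.
  rightPairs-pos : 2 ≤ n → leftPairs n T ≡ 1 → rightPairs n T ≢ 0
  rightPairs-pos 2≤n one none-right with countBelow-witness leftIn n (≤-reflexive (sym one))
  ... | p , p<n , Tp = x-uncrossed (IsCSPT-maximal isT (left x) (<-trans x<b p̄<2n) (only x a<x x<b))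
    where
    p̄<2n = +-monoˡ-< n p<n
    only = only-left-pair one p<n Tp
    A = find-apex Tp (HasLeft-mirror p<n Tp) (+-monoʳ-≤ p 2≤n) ≤-refl p̄<2n only
    open Apex A
    x-uncrossed : ¬ CrossedIn n T (left x)
    x-uncrossed (h , Th , cr) with apex-crossers Tp (HasLeft-mirror p<n Tp) ≤-refl A h Th cr
    ... | inj₁ refl = diag-not-long Th refl
    ... | inj₂ refl = not-¬ Th (centralPairs-empty R none-right p̄<2n)

  leftPairs≡1⇒rightPairs≡1 : 2 ≤ n → leftPairs n T ≡ 1 → rightPairs n T ≡ 1
  leftPairs≡1⇒rightPairs≡1 2≤n one with rightPairs n T in eq | rightPairs≤1 (≤-reflexive (sym one))
  ... | zero | _ = ⊥-elim (rightPairs-pos 2≤n one eq)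
  ... | suc zero | _ = refl
  ... | suc (suc _) | s≤s ()

  leftPairs≡n⇒leftStar : 2 ≤ n → leftPairs n T ≡ n → ∀ c → T c ≡ leftStar n c
  leftPairs≡n⇒leftStar 2≤n full (left y) with <-≤-connex y (n + n)
  ... | inj₁ y<2n = trans (centralPairs-full L full y<2n) (sym (<ᵇ-true y<2n))
  ... | inj₂ 2n≤y with T (left y) in Ty
  ...   | true = ⊥-elim (<⇒≱ (IsCSPT-valid isT (left y) Ty) 2n≤y)
  ...   | false = sym (<ᵇ-false 2n≤y)
  leftPairs≡n⇒leftStar 2≤n full (right q) with T (right q) in Tq
  ... | false = refl
  ... | true with right-crossed-by-left 2≤n (IsCSPT-valid isT (right q) Tq)
  ...   | y , y<2n , ccw = ⊥-elim (IsCSPT-noncrossing isT (left y) (right q) (centralPairs-full L full y<2n) Tq ccw)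
  leftPairs≡n⇒leftStar 2≤n full (diag a b) with T (diag a b) in Tab
  ... | false = refl
  ... | true with diag-crossed-by-central (IsCSPT-valid isT (diag a b) Tab)
  ...   | p , p<2n , arc = ⊥-elim (IsCSPT-noncrossing isT (diag a b) (left p) Tab (centralPairs-full L full p<2n) arc)

-- Lower bounds

m≤1+n⇒m∸o≤1+[n∸o] : ∀ {m n} o → m ≤ suc n → m ∸ o ≤ suc (n ∸ o)
m≤1+n⇒m∸o≤1+[n∸o] {m} {n} o m≤1+n = ≤-trans (∸-monoˡ-≤ o m≤1+n)
  (m≤n+o⇒m∸n≤o (suc n) o (subst (suc n ≤_) (sym (+-suc o (n ∸ o))) (s≤s (m≤n+m∸n n o))))

n≤1+m⇒o∸m≤1+[o∸n] : ∀ {m n} o → n ≤ suc m → o ∸ m ≤ suc (o ∸ n)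
n≤1+m⇒o∸m≤1+[o∸n] {m} {n} o n≤1+m = m≤n+o⇒m∸n≤o o m (begin
  o                 ≤⟨ m≤n+m∸n o n ⟩
  n + (o ∸ n)       ≤⟨ +-monoˡ-≤ (o ∸ n) n≤1+m ⟩
  suc m + (o ∸ n)   ≡⟨ sym (+-suc m (o ∸ n)) ⟩
  m + suc (o ∸ n)   ∎)
  where open ≤-Reasoning

potential≤length : ∀ {n target} (Φ : ChordSet → ℕ) →
  (∀ {T U} → Flip n T U → Φ T ≤ suc (Φ U)) → (∀ {T} → (∀ c → T c ≡ target c) → Φ T ≡ 0) →
  ∀ {T m} → FlipPath n T target m → Φ T ≤ m
potential≤length Φ drop vanish (done T≐target) = ≤-reflexive (vanish T≐target)
potential≤length Φ drop vanish (step fl path) = ≤-trans (drop fl) (s≤s (potential≤length Φ drop vanish path))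

leftPairs-leftStar : ∀ {n T} → (∀ c → T c ≡ leftStar n c) → leftPairs n T ≡ n
leftPairs-leftStar {n} T≐ = trans (countBelow-cong n (λ p _ → T≐ (left p)))
                                   (countBelow-all _ n (λ p p<n → <ᵇ-true (<-≤-trans p<n (m≤m+n n n))))

leftPairs-rightStar : ∀ {n T} → (∀ c → T c ≡ rightStar n c) → leftPairs n T ≡ 0
leftPairs-rightStar {n} T≐ = trans (countBelow-cong n (λ p _ → T≐ (left p))) (countBelow-none _ n (λ _ _ → refl))

rightPairs-rightStar : ∀ {n T} → (∀ c → T c ≡ rightStar n c) → rightPairs n T ≡ n
rightPairs-rightStar {n} T≐ = trans (countBelow-cong n (λ p _ → T≐ (right p)))
                                    (countBelow-all _ n (λ p p<n → <ᵇ-true (<-≤-trans p<n (m≤m+n n n))))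

leftStar-distance≥ : ∀ n {T m} → FlipPath n T (leftStar n) m → n ∸ leftPairs n T ≤ m
leftStar-distance≥ n = potential≤length (λ T → n ∸ leftPairs n T)
  (λ fl → n≤1+m⇒o∸m≤1+[o∸n] n (centralPairs-Flip L (Flip-sym fl)))
  (λ T≐ → trans (cong (n ∸_) (leftPairs-leftStar T≐)) (n∸n≡0 n))

n+1∸2≡n∸1 : ∀ n → n + 1 ∸ 2 ≡ n ∸ 1
n+1∸2≡n∸1 n = cong (_∸ 2) (+-comm n 1)

rightDistance : ℕ → ℕ → ℕ → ℕ
rightDistance n zero r = n ∸ r
rightDistance n (suc l) r = n + suc l ∸ 2

rightDistance-step : ∀ n {lT rT lU rU} → lU ≤ suc lT → lT ≤ suc lU → rU ≤ suc rT → (1 ≤ lT → rT ≤ 1) →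
                     rightDistance n lT rT ≤ suc (rightDistance n lU rU)
rightDistance-step n {zero} {rT} {zero} lU≤ _ rU≤ _ = n≤1+m⇒o∸m≤1+[o∸n] n rU≤
rightDistance-step n {zero} {rT} {suc zero} _ _ _ _ =
  ≤-trans (m∸n≤m n rT) (subst (λ z → n ≤ suc z) (sym (n+1∸2≡n∸1 n)) (n≤1+m⇒o∸m≤1+[o∸n] {0} {1} n ≤-refl))
rightDistance-step n {zero} {_} {suc (suc _)} (s≤s ()) _ _ _
rightDistance-step n {suc (suc _)} {_} {zero} _ (s≤s ()) _ _
rightDistance-step n {suc zero} {rT} {zero} {rU} _ _ rU≤ one-right = begin
  n + 1 ∸ 2        ≡⟨ n+1∸2≡n∸1 n ⟩
  n ∸ 1            ≤⟨ n≤1+m⇒o∸m≤1+[o∸n] {1} {2} n ≤-refl ⟩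
  suc (n ∸ 2)      ≤⟨ s≤s (∸-monoʳ-≤ n (≤-trans rU≤ (s≤s (one-right ≤-refl)))) ⟩
  suc (n ∸ rU)     ∎
  where open ≤-Reasoning
rightDistance-step n {suc lT} {_} {suc lU} _ lT≤ _ _ =
  m≤1+n⇒m∸o≤1+[n∸o] 2 (subst (n + suc lT ≤_) (+-suc n (suc lU)) (+-monoʳ-≤ n lT≤))

rightStar-distance≥ : ∀ n {T m} → FlipPath n T (rightStar n) m → rightDistance n (leftPairs n T) (rightPairs n T) ≤ m
rightStar-distance≥ n = potential≤length (λ T → rightDistance n (leftPairs n T) (rightPairs n T))
  (λ fl → rightDistance-step n (centralPairs-Flip L (Flip-sym fl)) (centralPairs-Flip L fl) (centralPairs-Flip R (Flip-sym fl))
                               (rightPairs≤1 (proj₁ fl)))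
  (λ T≐ → trans (cong₂ (rightDistance n) (leftPairs-rightStar T≐) (rightPairs-rightStar T≐)) (n∸n≡0 n))

-- Reflection

<-reverse : ∀ {x′ x y′ y k m} → x′ + x ≡ y′ + y → x + k < y + m → y′ + k < x′ + m
<-reverse {x′} {x} {y′} {y} {k} {m} e lt = +-cancelʳ-< x (y′ + k) (x′ + m) (begin-strict
  y′ + k + x     ≡⟨ xy∙z≈xz∙y y′ k x ⟩
  y′ + x + k     ≡⟨ +-assoc y′ x k ⟩
  y′ + (x + k)   <⟨ +-monoʳ-< y′ lt ⟩
  y′ + (y + m)   ≡⟨ sym (+-assoc y′ y m) ⟩
  y′ + y + m     ≡⟨ cong (_+ m) (sym e) ⟩
  x′ + x + m     ≡⟨ xy∙z≈xz∙y x′ x m ⟩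
  x′ + m + x     ∎)
  where open ≤-Reasoning

≤-reverse : ∀ {x′ x y′ y k m} → x′ + x ≡ y′ + y → x + k ≤ y + m → y′ + k ≤ x′ + m
≤-reverse {x′} {x} {y′} {y} {k} {m} e le = +-cancelʳ-≤ x (y′ + k) (x′ + m) (begin
  y′ + k + x     ≡⟨ xy∙z≈xz∙y y′ k x ⟩
  y′ + x + k     ≡⟨ +-assoc y′ x k ⟩
  y′ + (x + k)   ≤⟨ +-monoʳ-≤ y′ le ⟩
  y′ + (y + m)   ≡⟨ sym (+-assoc y′ y m) ⟩
  y′ + y + m     ≡⟨ cong (_+ m) (sym e) ⟩
  x′ + x + m     ≡⟨ xy∙z≈xz∙y x′ x m ⟩
  x′ + m + x     ∎)
  where open ≤-Reasoning

<-reverseʳ : ∀ {x′ x y′ y m} → x′ + x ≡ y′ + y → x < y + m → y′ < x′ + m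
<-reverseʳ {x′} {x} {y′} {y} {m} e lt =
  subst (_< x′ + m) (+-identityʳ y′) (<-reverse {k = 0} e (subst (_< y + m) (sym (+-identityʳ x)) lt))

<-reverseˡ : ∀ {x′ x y′ y k} → x′ + x ≡ y′ + y → x + k < y → y′ + k < x′
<-reverseˡ {x′} {x} {y′} {y} {k} e lt =
  subst (y′ + k <_) (+-identityʳ x′) (<-reverse {m = 0} e (subst (x + k <_) (sym (+-identityʳ y)) lt))

≤-reverseˡ : ∀ {x′ x y′ y k} → x′ + x ≡ y′ + y → x + k ≤ y → y′ + k ≤ x′
≤-reverseˡ {x′} {x} {y′} {y} {k} e le =
  subst (y′ + k ≤_) (+-identityʳ x′) (≤-reverse {m = 0} e (subst (x + k ≤_) (sym (+-identityʳ y)) le))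

<-reverse₀ : ∀ {x′ x y′ y} → x′ + x ≡ y′ + y → x < y → y′ < x′
<-reverse₀ {x′} {x} {y′} {y} e lt = subst (y′ <_) (+-identityʳ x′) (<-reverseʳ e (subst (x <_) (sym (+-identityʳ y)) lt))

-- Reflection of the polygon in the axis through vertex 0: p ↦ 2n - p (mod 2n).
reflect : ℕ → ℕ → ℕ
reflect n zero = zero
reflect n (suc p) = n + n ∸ suc p

data ReflectView (n p : ℕ) : Set where
  fixed : p ≡ 0 → reflect n p ≡ 0 → ReflectView n p
  moved : 0 < p → 0 < reflect n p → reflect n p + p ≡ n + n → ReflectView n p

reflectView : ∀ n {p} → p < n + n → ReflectView n p
reflectView n {zero} _ = fixed refl refl
reflectView n {suc p} 1+p<2n = moved (s≤s z≤n) (m<n⇒0<n∸m 1+p<2n) (m∸n+n≡m (<⇒≤ 1+p<2n))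

reflect-< : ∀ n {p} → p < n + n → reflect n p < n + n
reflect-< n {p} p<2n with reflectView n p<2n
... | fixed _ e = subst (_< n + n) (sym e) (≤-<-trans z≤n p<2n)
... | moved 0<p _ e = subst (reflect n p <_) e (m<m+n (reflect n p) 0<p)

reflect-involutive : ∀ n {p} → p < n + n → reflect n (reflect n p) ≡ p
reflect-involutive n {p} p<2n with reflectView n p<2n
... | fixed refl e = cong (reflect n) e
... | moved _ 0<p′ e with reflectView n (reflect-< n p<2n)
...   | fixed p′≡0 _ = ⊥-elim (<-irrefl (sym p′≡0) 0<p′)
...   | moved _ _ e′ = +-cancelˡ-≡ (reflect n p) _ _ (trans (+-comm (reflect n p) _) (trans e′ (sym e)))

reflect-n : ∀ n → 0 < n → reflect n n ≡ n
reflect-n n 0<n with reflectView n (m<m+n n 0<n)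
... | fixed n≡0 _ = ⊥-elim (<-irrefl (sym n≡0) 0<n)
... | moved _ _ e = +-cancelʳ-≡ n _ _ e

reflect-+n : ∀ n {k} → k < n → reflect n (k + n) ≡ bar n (reflect n k)
reflect-+n n {zero} 0<n = trans (reflect-n n 0<n) (sym (bar-low {n} 0<n))
reflect-+n n {suc j} 1+j<n = begin
  n + n ∸ (suc j + n)   ≡⟨ cong (n + n ∸_) (+-comm (suc j) n) ⟩
  n + n ∸ (n + suc j)   ≡⟨ [m+n]∸[m+o]≡n∸o n n (suc j) ⟩
  n ∸ suc j             ≡⟨ sym (bar-high {n} (n ∸ suc j)) ⟩
  bar n (n ∸ suc j + n) ≡⟨ cong (bar n) (sym (+-∸-comm n (<⇒≤ 1+j<n))) ⟩
  bar n (n + n ∸ suc j) ∎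
  where open ≡-Reasoning

reflect-bar : ∀ n {p} → p < n + n → reflect n (bar n p) ≡ bar n (reflect n p)
reflect-bar n {p} p<2n with barView n p
... | low p<n e = trans (cong (reflect n) e) (reflect-+n n p<n)
... | high k refl e = begin
  reflect n (bar n (k + n))        ≡⟨ cong (reflect n) e ⟩
  reflect n k                      ≡⟨ sym (bar-involutive {n} (reflect-< n (<-≤-trans k<n (m≤m+n n n)))) ⟩
  bar n (bar n (reflect n k))      ≡⟨ cong (bar n) (sym (reflect-+n n k<n)) ⟩
  bar n (reflect n (k + n))        ∎
  where
  open ≡-Reasoning
  k<n = +-cancelʳ-< n k n p<2n

sortedDiag-map : ∀ (f : ℕ → ℕ) u v → sortedDiag (f (u ⊓ v)) (f (u ⊔ v)) ≡ sortedDiag (f u) (f v)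
sortedDiag-map f u v with ≤-total u v
... | inj₁ u≤v rewrite m≤n⇒m⊓n≡m u≤v | m≤n⇒m⊔n≡n u≤v = refl
... | inj₂ v≤u rewrite m≥n⇒m⊓n≡n v≤u | m≥n⇒m⊔n≡m v≤u = sortedDiag-comm (f v) (f u)

reflectChord : ℕ → Chord → Chord
reflectChord n (diag a b) = sortedDiag (reflect n a) (reflect n b)
reflectChord n (left p) = right (reflect n p)
reflectChord n (right p) = left (reflect n p)

reflectChord-involutive : ∀ n c → Valid n c → reflectChord n (reflectChord n c) ≡ c
reflectChord-involutive n (left p) v = cong left (reflect-involutive n v)
reflectChord-involutive n (right p) v = cong right (reflect-involutive n v)
reflectChord-involutive n (diag a b) (a<b , b<2n , _) = begin
  reflectChord n (sortedDiag (reflect n a) (reflect n b))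
    ≡⟨ sortedDiag-map (reflect n) (reflect n a) (reflect n b) ⟩
  sortedDiag (reflect n (reflect n a)) (reflect n (reflect n b))
    ≡⟨ cong₂ sortedDiag (reflect-involutive n (<-trans a<b b<2n)) (reflect-involutive n b<2n) ⟩
  sortedDiag a b
    ≡⟨ sortedDiag-≤ (<⇒≤ a<b) ⟩
  diag a b ∎
  where open ≡-Reasoning

reflectChord-csym : ∀ n c → Valid n c → reflectChord n (csym n c) ≡ csym n (reflectChord n c)
reflectChord-csym n (left p) v = cong right (reflect-bar n v)
reflectChord-csym n (right p) v = cong left (reflect-bar n v)
reflectChord-csym n (diag a b) (a<b , b<2n , _) = begin
  reflectChord n (sortedDiag (bar n a) (bar n b))
    ≡⟨ sortedDiag-map (reflect n) (bar n a) (bar n b) ⟩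
  sortedDiag (reflect n (bar n a)) (reflect n (bar n b))
    ≡⟨ cong₂ sortedDiag (reflect-bar n (<-trans a<b b<2n)) (reflect-bar n b<2n) ⟩
  sortedDiag (bar n (reflect n a)) (bar n (reflect n b))
    ≡⟨ sym (sortedDiag-map (bar n) (reflect n a) (reflect n b)) ⟩
  csym n (reflectChord n (diag a b)) ∎
  where open ≡-Reasoning

data ReflectDiagView (n a b : ℕ) : Set where
  from-0   : a ≡ 0 → 0 < reflect n b → reflect n b + b ≡ n + n → ReflectDiagView n a b
  positive : 0 < a → 0 < reflect n b → reflect n a + a ≡ n + n → reflect n b + b ≡ n + n →
             reflectChord n (diag a b) ≡ diag (reflect n b) (reflect n a) → ReflectDiagView n a b

reflectDiagView : ∀ n {a b} → a < b → b < n + n → ReflectDiagView n a b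
reflectDiagView n {a} {b} a<b b<2n with reflectView n (<-trans a<b b<2n) | reflectView n b<2n
... | fixed refl _ | moved _ 0<b′ eb = from-0 refl 0<b′ eb
... | _ | fixed refl _ = ⊥-elim (<⇒≱ a<b z≤n)
... | moved 0<a _ ea | moved _ 0<b′ eb =
  positive 0<a 0<b′ ea eb (trans (sortedDiag-comm (reflect n a) (reflect n b)) (sortedDiag-≤ (<⇒≤ b′<a′)))
  where
  b′<a′ : reflect n b < reflect n a
  b′<a′ = <-reverse₀ (trans ea (sym eb)) a<b

reflectChord-valid : ∀ n c → Valid n c → Valid n (reflectChord n c)
reflectChord-valid n (left p) v = reflect-< n v
reflectChord-valid n (right p) v = reflect-< n v
reflectChord-valid n (diag a b) v with Valid⇒ValidDiag v
... | mkValidDiag a<b b<2n a+2≤b b≢a+n b+2≤a+2n with reflectDiagView n a<b b<2n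
...   | from-0 refl 0<b′ eb = ValidDiag⇒Valid (mkValidDiag 0<b′ b′<2n 2≤b′ b′≢n b′+2≤2n)
  where
  b′ = reflect n b
  b′<2n : b′ < n + n
  b′<2n = subst (b′ <_) eb (m<m+n b′ a<b)
  2≤b′ : 2 ≤ b′
  2≤b′ = +-cancelˡ-≤ b 2 b′ (subst (b + 2 ≤_) (trans (sym eb) (+-comm b′ b)) b+2≤a+2n)
  b′≢n : b′ ≢ n
  b′≢n e = b≢a+n (+-cancelˡ-≡ n b n (trans (cong (_+ b) (sym e)) eb))
  b′+2≤2n : b′ + 2 ≤ n + n
  b′+2≤2n = subst (b′ + 2 ≤_) eb (+-monoʳ-≤ b′ a+2≤b)
...   | positive 0<a _ ea eb e = subst (Valid n) (sym e) (ValidDiag⇒Valid (mkValidDiag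
          (<-reverse₀ ea′ a<b)
          (subst (a′ <_) ea (m<m+n a′ 0<a))
          (≤-reverseˡ ea′ a+2≤b)
          a′≢b′+n
          (≤-reverse {k = 2} {m = n + n} (sym ea′) b+2≤a+2n)))
  where
  a′ = reflect n a
  b′ = reflect n b
  ea′ : a′ + a ≡ b′ + b
  ea′ = trans ea (sym eb)
  a′≢b′+n : a′ ≢ b′ + n
  a′≢b′+n e = b≢a+n (+-cancelˡ-≡ b′ b (a + n) (sym (begin
    b′ + (a + n)   ≡⟨ sym (+-assoc b′ a n) ⟩
    b′ + a + n     ≡⟨ xy∙z≈xz∙y b′ a n ⟩
    b′ + n + a     ≡⟨ cong (_+ a) (sym e) ⟩
    a′ + a         ≡⟨ ea′ ⟩
    b′ + b         ∎)))
    where open ≡-Reasoning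

reflect-CCW : ∀ n {p q} → p < n + n → q < n + n → CCW n p q → CCW n (reflect n q) (reflect n p)
reflect-CCW n {p} {q} p<2n q<2n ccw with reflectView n p<2n | reflectView n q<2n | ccw
... | fixed refl _ | fixed refl _ | inj₁ (() , _)
... | fixed refl _ | fixed refl _ | inj₂ ()
... | fixed refl _ | moved _ _ eq | inj₁ (_ , q<n) = inj₂ (<-reverse₀ {reflect n q} {q} {n} {n} eq q<n)
... | fixed refl _ | moved _ _ _ | inj₂ ()
... | moved _ _ _ | fixed refl _ | inj₁ (() , _)
... | moved _ 0<p′ ep | fixed refl _ | inj₂ n<p = inj₁ (0<p′ , <-reverse₀ {n} {n} {reflect n p} {p} (sym ep) n<p)
... | moved _ _ ep | moved _ _ eq | inj₁ (p<q , q<p+n) =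
  inj₁ (<-reverse₀ (trans ep (sym eq)) p<q , <-reverseʳ (trans eq (sym ep)) q<p+n)
... | moved _ _ ep | moved _ _ eq | inj₂ q+n<p =
  inj₂ (<-reverseˡ (trans eq (sym ep)) q+n<p)

reflect-InShort : ∀ n {a b p} → Valid n (diag a b) → p < n + n → InShort n a b p →
                  Crosses n (reflectChord n (diag a b)) (left (reflect n p))
reflect-InShort n {a} {b} {p} (a<b , b<2n , _) p<2n ins
  with reflectDiagView n a<b b<2n | reflectView n p<2n | InShort⇒InShortArc (<⇒≤ a<b) ins
... | from-0 refl _ _ | fixed refl _ | inj₁ (_ , () , _)
... | from-0 refl _ _ | fixed refl _ | inj₂ (_ , inj₁ ())
... | from-0 refl _ _ | fixed refl _ | inj₂ (_ , inj₂ ())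
... | from-0 refl _ eb | moved _ 0<p′ ep | inj₁ (b<n , _ , p<b) =
  InShortArc⇒InShort z≤n (inj₂ (<-reverse₀ {reflect n b} {b} {n} {n} eb b<n , inj₂ (<-reverse₀ (trans ep (sym eb)) p<b)))
... | from-0 refl _ _ | moved _ _ _ | inj₂ (_ , inj₁ ())
... | from-0 refl _ eb | moved _ 0<p′ ep | inj₂ (n<b , inj₂ b<p) =
  InShortArc⇒InShort z≤n (inj₁ (<-reverse₀ {n} {n} {reflect n b} {b} (sym eb) n<b , 0<p′ , <-reverse₀ (trans eb (sym ep)) b<p))
... | positive _ _ _ _ _ | fixed refl _ | inj₁ (_ , () , _)
... | positive _ 0<b′ ea eb e | fixed refl _ | inj₂ (a+n<b , inj₁ _) =
  subst (λ c → Crosses n c (left 0)) (sym e) (InShortArc⇒InShort (<⇒≤ (<-reverse₀ (trans ea (sym eb)) a<b))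
    (inj₂ (<-reverseˡ (trans ea (sym eb)) a+n<b , inj₁ 0<b′)))
... | positive _ _ _ _ _ | fixed refl _ | inj₂ (_ , inj₂ ())
... | positive _ _ ea eb e | moved _ _ ep | arc =
  subst (λ c → Crosses n c (left (reflect n p))) (sym e) (InShortArc⇒InShort (<⇒≤ (<-reverse₀ (trans ea (sym eb)) a<b)) (go arc))
  where
  go : InShortArc n a b p → InShortArc n (reflect n b) (reflect n a) (reflect n p)
  go (inj₁ (b<a+n , a<p , p<b)) =
    inj₁ (<-reverseʳ (trans eb (sym ea)) b<a+n ,
          <-reverse₀ (trans ep (sym eb)) p<b , <-reverse₀ (trans ea (sym ep)) a<p)
  go (inj₂ (a+n<b , inj₁ p<a)) = inj₂ (<-reverseˡ (trans ea (sym eb)) a+n<b , inj₂ (<-reverse₀ (trans ep (sym ea)) p<a))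
  go (inj₂ (a+n<b , inj₂ b<p)) = inj₂ (<-reverseˡ (trans ea (sym eb)) a+n<b , inj₁ (<-reverse₀ (trans eb (sym ep)) b<p))

reflect-Interleaved : ∀ n {a b c d} → Valid n (diag a b) → Valid n (diag c d) → Interleaved a b c d →
                      Crosses n (reflectChord n (diag a b)) (reflectChord n (diag c d))
reflect-Interleaved n {a} {b} {c} {d} (a<b , b<2n , _) (c<d , d<2n , _) x
  with reflectDiagView n a<b b<2n | reflectDiagView n c<d d<2n | x
... | from-0 refl _ _ | from-0 refl _ _ | inj₁ (() , _)
... | from-0 refl _ _ | from-0 refl _ _ | inj₂ (() , _)
... | from-0 refl _ eb | positive _ 0<d′ ec ed e₂ | inj₁ (_ , c<b , b<d) =
  subst (Crosses n (reflectChord n (diag 0 b))) (sym e₂)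
        (inj₁ (0<d′ , <-reverse₀ (trans eb (sym ed)) b<d , <-reverse₀ (trans ec (sym eb)) c<b))
... | from-0 refl _ _ | positive _ _ _ _ _ | inj₂ (() , _)
... | positive _ _ _ _ _ | from-0 refl _ _ | inj₁ (() , _)
... | positive _ 0<b′ ea eb e₁ | from-0 refl _ ed | inj₂ (_ , a<d , d<b) =
  subst (λ z → Crosses n z (reflectChord n (diag 0 d))) (sym e₁)
        (inj₂ (0<b′ , <-reverse₀ (trans ed (sym eb)) d<b , <-reverse₀ (trans ea (sym ed)) a<d))
... | positive _ _ ea eb e₁ | positive _ _ ec ed e₂ | inj₁ (a<c , c<b , b<d) =
  subst₂ (Crosses n) (sym e₁) (sym e₂)
    (inj₂ (<-reverse₀ (trans eb (sym ed)) b<d , <-reverse₀ (trans ec (sym eb)) c<b , <-reverse₀ (trans ea (sym ec)) a<c))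
... | positive _ _ ea eb e₁ | positive _ _ ec ed e₂ | inj₂ (c<a , a<d , d<b) =
  subst₂ (Crosses n) (sym e₁) (sym e₂)
    (inj₁ (<-reverse₀ (trans ed (sym eb)) d<b , <-reverse₀ (trans ea (sym ed)) a<d , <-reverse₀ (trans ec (sym ea)) c<a))

reflectChord-Crosses : ∀ n c d → Valid n c → Valid n d → Crosses n c d → Crosses n (reflectChord n c) (reflectChord n d)
reflectChord-Crosses n (diag a b) (diag c d) vc vd x = reflect-Interleaved n vc vd x
reflectChord-Crosses n (diag a b) (left p) vc vd x = reflect-InShort n vc vd x
reflectChord-Crosses n (diag a b) (right p) vc vd x = reflect-InShort n vc vd x
reflectChord-Crosses n (left p) (diag a b) vc vd x = reflect-InShort n vd vc x
reflectChord-Crosses n (right p) (diag a b) vc vd x = reflect-InShort n vd vc x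
reflectChord-Crosses n (left p) (right q) vc vd x = reflect-CCW n vc vd x
reflectChord-Crosses n (right q) (left p) vc vd x = reflect-CCW n vd vc x

valid? : ∀ n c → Dec (Valid n c)
valid? n (diag a b) = (a <? b) ×-dec (b <? n + n) ×-dec (2 ≤? b ∸ a) ×-dec ¬? (b ∸ a ≟ n) ×-dec (b ∸ a + 2 ≤? n + n)
valid? n (left p) = p <? n + n
valid? n (right p) = p <? n + n

-- Restricted to valid chords, on which reflectChord is an involution.
reflectSet : ℕ → ChordSet → ChordSet
reflectSet n T c = if does (valid? n c) then T (reflectChord n c) else false

reflectSet-valid : ∀ n T {c} → Valid n c → reflectSet n T c ≡ T (reflectChord n c)
reflectSet-valid n T {c} vc with valid? n c
... | yes _ = refl
... | no ¬vc = ⊥-elim (¬vc vc)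

reflectSet-true⇒valid : ∀ n T {c} → reflectSet n T c ≡ true → Valid n c
reflectSet-true⇒valid n T {c} e with valid? n c
... | yes vc = vc

reflectSet-reflectChord : ∀ n T {c} → Valid n c → reflectSet n T (reflectChord n c) ≡ T c
reflectSet-reflectChord n T {c} vc =
  trans (reflectSet-valid n T (reflectChord-valid n c vc)) (cong T (reflectChord-involutive n c vc))

reflectChord-swap : ∀ n {e x} → Valid n e → reflectChord n e ≡ x → e ≡ reflectChord n x
reflectChord-swap n {e} ve eq = trans (sym (reflectChord-involutive n e ve)) (cong (reflectChord n) eq)

IsCSPT-reflect : ∀ {n T} → IsCSPT n T → IsCSPT n (reflectSet n T)
IsCSPT-reflect {n} {T} isT = valid , noncrossing , maximal , symmetric
  where
  valid : ∀ c → reflectSet n T c ≡ true → Valid n c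
  valid c = reflectSet-true⇒valid n T
  member : ∀ {c} → reflectSet n T c ≡ true → T (reflectChord n c) ≡ true
  member e = trans (sym (reflectSet-valid n T (valid _ e))) e
  noncrossing : ∀ c c′ → reflectSet n T c ≡ true → reflectSet n T c′ ≡ true → ¬ Crosses n c c′
  noncrossing c c′ e e′ x =
    IsCSPT-noncrossing isT _ _ (member e) (member e′) (reflectChord-Crosses n c c′ (valid c e) (valid c′ e′) x)
  maximal : ∀ c → Valid n c → reflectSet n T c ≡ false → CrossedIn n (reflectSet n T) c
  maximal c vc e with IsCSPT-maximal isT (reflectChord n c) (reflectChord-valid n c vc) (trans (sym (reflectSet-valid n T vc)) e)
  ... | h , Th , x = reflectChord n h , trans (reflectSet-reflectChord n T vh) Th ,
                     subst (λ z → Crosses n z (reflectChord n h)) (reflectChord-involutive n c vc)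
                           (reflectChord-Crosses n (reflectChord n c) h (reflectChord-valid n c vc) vh x)
    where vh = IsCSPT-valid isT h Th
  symmetric : ∀ c → reflectSet n T c ≡ true → reflectSet n T (csym n c) ≡ true
  symmetric c e = trans (reflectSet-valid n T (csym-valid n c vc))
                        (trans (cong T (reflectChord-csym n c vc)) (IsCSPT-symmetric isT _ (member e)))
    where vc = valid c e

Flip-reflect : ∀ {n T U} → Flip n T U → Flip n (reflectSet n T) (reflectSet n U)
Flip-reflect {n} {T} {U} (isT , isU , c , d , Tc , Uc , Td , Ud , same) =
  IsCSPT-reflect isT , IsCSPT-reflect isU , reflectChord n c , reflectChord n d ,
  trans (reflectSet-reflectChord n T vc) Tc , trans (reflectSet-reflectChord n U vc) Uc ,
  trans (reflectSet-reflectChord n T vd) Td , trans (reflectSet-reflectChord n U vd) Ud ,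
  same′
  where
  vc = IsCSPT-valid isT c Tc
  vd = IsCSPT-valid isU d Ud
  same′ : ∀ e → e ≢ reflectChord n c → e ≢ csym n (reflectChord n c) →
                e ≢ reflectChord n d → e ≢ csym n (reflectChord n d) → reflectSet n T e ≡ reflectSet n U e
  same′ e e≢c e≢c̄ e≢d e≢d̄ with valid? n e
  ... | no _ = refl
  ... | yes ve = same (reflectChord n e)
    (λ x → e≢c (reflectChord-swap n ve x))
    (λ x → e≢c̄ (trans (reflectChord-swap n ve x) (reflectChord-csym n c vc)))
    (λ x → e≢d (reflectChord-swap n ve x))
    (λ x → e≢d̄ (trans (reflectChord-swap n ve x) (reflectChord-csym n d vd)))

FlipPath-reflect : ∀ {n T T′ k} → FlipPath n T T′ k → FlipPath n (reflectSet n T) (reflectSet n T′) k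
FlipPath-reflect {n} (done same) = done (λ c → cong (if does (valid? n c) then_else false) (same (reflectChord n c)))
FlipPath-reflect (step fl path) = step (Flip-reflect fl) (FlipPath-reflect path)

_≐_ : ChordSet → ChordSet → Set
T ≐ T′ = ∀ c → T c ≡ T′ c

IsCSPT-≐ : ∀ {n T T′} → IsCSPT n T → T ≐ T′ → IsCSPT n T′
IsCSPT-≐ {n} {T} {T′} isT T≐T′ =
  (λ c e → IsCSPT-valid isT c (trans (T≐T′ c) e)) ,
  (λ c c′ e e′ → IsCSPT-noncrossing isT c c′ (trans (T≐T′ c) e) (trans (T≐T′ c′) e′)) ,
  (λ c vc e → let (h , Th , x) = IsCSPT-maximal isT c vc (trans (T≐T′ c) e) in h , trans (sym (T≐T′ h)) Th , x) ,
  (λ c e → trans (sym (T≐T′ (csym n c))) (IsCSPT-symmetric isT c (trans (T≐T′ c) e)))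

Flip-≐ : ∀ {n T T′ U U′} → Flip n T U → T ≐ T′ → U ≐ U′ → Flip n T′ U′
Flip-≐ (isT , isU , c , d , Tc , Uc , Td , Ud , same) T≐ U≐ =
  IsCSPT-≐ isT T≐ , IsCSPT-≐ isU U≐ , c , d ,
  trans (sym (T≐ c)) Tc , trans (sym (U≐ c)) Uc , trans (sym (T≐ d)) Td , trans (sym (U≐ d)) Ud ,
  (λ e e≢c e≢c̄ e≢d e≢d̄ → trans (sym (T≐ e)) (trans (same e e≢c e≢c̄ e≢d e≢d̄) (U≐ e)))

FlipPath-≐ : ∀ {n T T′ S S′ k} → FlipPath n T S k → T ≐ T′ → S ≐ S′ → FlipPath n T′ S′ k
FlipPath-≐ (done same) T≐ S≐ = done (λ c → trans (sym (T≐ c)) (trans (same c) (S≐ c)))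
FlipPath-≐ (step fl path) T≐ S≐ = step (Flip-≐ fl T≐ (λ _ → refl)) (FlipPath-≐ path (λ _ → refl) S≐)

reflectSet-involutive : ∀ {n T} → IsCSPT n T → reflectSet n (reflectSet n T) ≐ T
reflectSet-involutive {n} {T} isT c with valid? n c
... | yes vc = trans (reflectSet-valid n T (reflectChord-valid n c vc)) (cong T (reflectChord-involutive n c vc))
... | no ¬vc with T c in Tc
...   | false = refl
...   | true = ⊥-elim (¬vc (IsCSPT-valid isT c Tc))

reflectSet-false : ∀ n T c → (Valid n c → T (reflectChord n c) ≡ false) → reflectSet n T c ≡ false
reflectSet-false n T c absent with valid? n c
... | yes vc = absent vc
... | no _ = refl

reflectSet-leftStar : ∀ n → reflectSet n (leftStar n) ≐ rightStar n
reflectSet-leftStar n (right p) with <-≤-connex p (n + n)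
... | inj₁ p<2n = trans (reflectSet-valid n (leftStar n) p<2n) (trans (<ᵇ-true (reflect-< n p<2n)) (sym (<ᵇ-true p<2n)))
... | inj₂ 2n≤p =
  trans (reflectSet-false n (leftStar n) (right p) (λ p<2n → ⊥-elim (<⇒≱ p<2n 2n≤p))) (sym (<ᵇ-false 2n≤p))
reflectSet-leftStar n (left p) = reflectSet-false n (leftStar n) (left p) (λ _ → refl)
reflectSet-leftStar n (diag a b) = reflectSet-false n (leftStar n) (diag a b) (λ _ → refl)

reflectSet-rightStar : ∀ n → reflectSet n (rightStar n) ≐ leftStar n
reflectSet-rightStar n (left p) with <-≤-connex p (n + n)
... | inj₁ p<2n = trans (reflectSet-valid n (rightStar n) p<2n) (trans (<ᵇ-true (reflect-< n p<2n)) (sym (<ᵇ-true p<2n)))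
... | inj₂ 2n≤p =
  trans (reflectSet-false n (rightStar n) (left p) (λ p<2n → ⊥-elim (<⇒≱ p<2n 2n≤p))) (sym (<ᵇ-false 2n≤p))
reflectSet-rightStar n (right p) = reflectSet-false n (rightStar n) (right p) (λ _ → refl)
reflectSet-rightStar n (diag a b) = reflectSet-false n (rightStar n) (diag a b) (λ _ → refl)
-- On 1 … n-1, reflect followed by bar is i ↦ n - i, so a bar-invariant count is unchanged.
countBelow-reflect : ∀ n (f : ℕ → Bool) → (∀ q → q < n + n → f (bar n q) ≡ f q) →
                     countBelow (f ∘′ reflect n) n ≡ countBelow f n
countBelow-reflect zero f _ = refl
countBelow-reflect (suc m) f f-bar = begin
  countBelow (f ∘′ reflect (suc m)) (suc m)
    ≡⟨ countBelow-suc (f ∘′ reflect (suc m)) m ⟩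
  countBelow (λ _ → f 0) 1 + countBelow (λ i → f (reflect (suc m) (suc i))) m
    ≡⟨ cong (countBelow (λ _ → f 0) 1 +_) (countBelow-cong m (λ i i<m → f-reflect i i<m)) ⟩
  countBelow (λ _ → f 0) 1 + countBelow (λ i → f (m ∸ i)) m
    ≡⟨ cong (countBelow (λ _ → f 0) 1 +_) (countBelow-reverse f m) ⟩
  countBelow (λ _ → f 0) 1 + countBelow (f ∘′ suc) m
    ≡⟨ sym (countBelow-suc f m) ⟩
  countBelow f (suc m) ∎
  where
  open ≡-Reasoning
  f-reflect : ∀ i → i < m → f (reflect (suc m) (suc i)) ≡ f (m ∸ i)
  f-reflect i i<m = begin
    f (suc m + suc m ∸ suc i) ≡⟨ cong f (+-∸-comm (suc m) (s≤s (<⇒≤ i<m))) ⟩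
    f (m ∸ i + suc m)         ≡⟨ sym (f-bar _ (+-monoˡ-< (suc m) (s≤s (m∸n≤m m i)))) ⟩
    f (bar (suc m) (m ∸ i + suc m)) ≡⟨ cong f (bar-high {suc m} (m ∸ i)) ⟩
    f (m ∸ i) ∎

centralPairs-reflect : ∀ s {n T} → IsCSPT n T → centralPairs s n (reflectSet n T) ≡ centralPairs (opposite s) n T
centralPairs-reflect s {n} {T} isT = begin
  countBelow (λ p → reflectSet n T (central s p)) n
    ≡⟨ countBelow-cong n (λ p p<n → trans (reflectSet-valid n T (central-valid s (<-≤-trans p<n (m≤m+n n n))))
                                          (cong T (reflect-central s p))) ⟩
  countBelow (λ p → T (central (opposite s) (reflect n p))) n
    ≡⟨ countBelow-reflect n (λ q → T (central (opposite s) q)) (λ q q<2n → T-central-bar (opposite s) q<2n) ⟩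
  countBelow (λ q → T (central (opposite s) q)) n ∎
  where
  open ≡-Reasoning
  reflect-central : ∀ s p → reflectChord n (central s p) ≡ central (opposite s) (reflect n p)
  reflect-central L p = refl
  reflect-central R p = refl
  T-central-bar : ∀ s {q} → q < n + n → T (central s (bar n q)) ≡ T (central s q)
  T-central-bar s {q} q<2n = trans (cong T (sym (csym-central s n q))) (IsCSPT-csym isT (central s q) (central-valid s q<2n))

FlipDist-reflect : ∀ {n T S S′ k} → IsCSPT n T → reflectSet n S ≐ S′ → reflectSet n S′ ≐ S →
                   FlipDist n (reflectSet n T) S k → FlipDist n T S′ k
FlipDist-reflect isT S↦S′ S′↦S (path , shortest) =
  FlipPath-≐ (FlipPath-reflect path) (reflectSet-involutive isT) S↦S′ ,
  λ m path′ → shortest m (FlipPath-≐ (FlipPath-reflect path′) (λ _ → refl) S′↦S)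

-- Flip distances to the stars

module _ {n : ℕ} (2≤n : 2 ≤ n) where

  path-to-leftStar : ∀ k {T} → IsCSPT n T → 1 ≤ leftPairs n T → leftPairs n T + k ≡ n → FlipPath n T (leftStar n) k
  path-to-leftStar zero isT _ full = done (leftPairs≡n⇒leftStar isT 2≤n (trans (sym (+-identityʳ _)) full))
  path-to-leftStar (suc k) {T} isT some l+1+k≡n with Increase.left-increase n isT some l<n
    where
    l<n : leftPairs n T < n
    l<n = subst (leftPairs n T <_) l+1+k≡n (m<m+n (leftPairs n T) (s≤s z≤n))
  ... | U , fl , lU≡1+lT = step fl (path-to-leftStar k (proj₁ (proj₂ fl)) (subst (1 ≤_) (sym lU≡1+lT) (s≤s z≤n))
                                      (trans (cong (_+ k) lU≡1+lT) (trans (sym (+-suc _ k)) l+1+k≡n)))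

  -- With a single left pair there is a single right pair; reflecting turns it into a single left pair.
  path-to-rightStar : ∀ j {T} → IsCSPT n T → leftPairs n T ≡ suc j → FlipPath n T (rightStar n) (j + (n ∸ 1))
  path-to-rightStar zero {T} isT one =
    FlipPath-≐ (FlipPath-reflect (path-to-leftStar (n ∸ 1) (IsCSPT-reflect isT) (≤-reflexive (sym l′≡1))
                                   (trans (cong (_+ (n ∸ 1)) l′≡1) (m+[n∸m]≡n (≤-trans (s≤s z≤n) 2≤n)))))
               (reflectSet-involutive isT) (reflectSet-leftStar n)
    where
    l′≡1 : leftPairs n (reflectSet n T) ≡ 1
    l′≡1 = trans (centralPairs-reflect L isT) (leftPairs≡1⇒rightPairs≡1 isT 2≤n one)
  path-to-rightStar (suc j) isT l≡2+j with Decrease.left-decrease n isT (subst (2 ≤_) (sym l≡2+j) (s≤s (s≤s z≤n)))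
  ... | U , fl , lT≡1+lU = step fl (path-to-rightStar j (proj₁ (proj₂ fl)) (suc-injective (trans (sym lT≡1+lU) l≡2+j)))

  distances-by-leftPairs : ∀ {T} → IsCSPT n T → 1 ≤ leftPairs n T →
    FlipDist n T (leftStar n) (n ∸ leftPairs n T) × FlipDist n T (rightStar n) (n + leftPairs n T ∸ 2)
  distances-by-leftPairs {T} isT some =
    (path-to-leftStar (n ∸ leftPairs n T) isT some (m+[n∸m]≡n (countBelow-≤ _ n)) , λ _ → leftStar-distance≥ n) ,
    (to-rightStar , λ _ path → subst (_≤ _) (rightDistance-pos (leftPairs n T) some) (rightStar-distance≥ n path))
    where
    rightDistance-pos : ∀ l {r} → 1 ≤ l → rightDistance n l r ≡ n + l ∸ 2
    rightDistance-pos (suc l) _ = refl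
    to-rightStar : FlipPath n T (rightStar n) (n + leftPairs n T ∸ 2)
    to-rightStar with leftPairs n T in eq
    ... | suc j = subst (FlipPath n T (rightStar n)) (begin
      j + (n ∸ 1)      ≡⟨ sym (+-∸-assoc j (≤-trans (s≤s z≤n) 2≤n)) ⟩
      j + n ∸ 1        ≡⟨ cong (_∸ 1) (+-comm j n) ⟩
      suc (n + j) ∸ 2  ≡⟨ cong (_∸ 2) (sym (+-suc n j)) ⟩
      n + suc j ∸ 2    ∎) (path-to-rightStar j isT eq)
      where open ≡-Reasoning

  distances-by-rightPairs : ∀ {T} → IsCSPT n T → 1 ≤ rightPairs n T →
    FlipDist n T (rightStar n) (n ∸ rightPairs n T) × FlipDist n T (leftStar n) (n + rightPairs n T ∸ 2)
  distances-by-rightPairs {T} isT some =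
    subst (λ l → FlipDist n T (rightStar n) (n ∸ l) × FlipDist n T (leftStar n) (n + l ∸ 2)) l′≡r
      (map (FlipDist-reflect isT (reflectSet-leftStar n) (reflectSet-rightStar n))
           (FlipDist-reflect isT (reflectSet-rightStar n) (reflectSet-leftStar n))
           (distances-by-leftPairs (IsCSPT-reflect isT) (subst (1 ≤_) (sym l′≡r) some)))
    where
    l′≡r : leftPairs n (reflectSet n T) ≡ rightPairs n T
    l′≡r = centralPairs-reflect L isT

lemma3p3 : (n : ℕ) → 2 ≤ n → (T : ChordSet) → IsCSPT n T →
    (1 ≤ leftPairs n T →
      FlipDist n T (leftStar n) (n ∸ leftPairs n T) ×
      FlipDist n T (rightStar n) (n + leftPairs n T ∸ 2)) ×
    (1 ≤ rightPairs n T →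
      FlipDist n T (rightStar n) (n ∸ rightPairs n T) ×
      FlipDist n T (leftStar n) (n + rightPairs n T ∸ 2))
lemma3p3 n 2≤n T isT = distances-by-leftPairs 2≤n isT , distances-by-rightPairs 2≤n isT
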